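{- Let $n\ge 4$, let $H$ be either $H_{n,1,2}$ or $H_{n,2,2}$, and let $G$ be a 2-vertex connected graph on $n$ vertices such that $$\sum_{x\in V(G)} k(x) < b(G)+\sum_{x\in V(H)} k(x).$$ Then $W(G)<W(H)$.
   Context: All graphs are finite and simple. For a connected graph $G$, $d_G(u,v)$ is the distance between $u$ and $v$, and the Wiener index is $W(G)=\sum_{\{u,v\}\subseteq V(G)} d_G(u,v)$ (sum over unordered pairs of distinct vertices). For integers $p,q$ with $1\le p\le q\le n-p-q+1$ and $q>1$, $H_{n,p,q}$ is the graph on $n$ vertices consisting of three internally disjoint paths between the same two end-vertices, of lengths $p$, $q$ and $n-p-q+1$ (a path of length 1 is an edge). For a connected graph $G$ on $n$ vertices and $v\in V(G)$, the distance vector $\omega_G(v)$ is the $(n-1)$-dimensional vector with $\omega_G(v)_i=|\{x\in V(G): d_G(v,x)=i\}|$. Let $k(v)$ be the smallest index $i$ with $\omega_G(v)_i>2$; if no such index exists, $k(v)=\lfloor n/2\rfloor$ (this is computed in whichever graph $v$ belongs to). A vertex $x$ of $G$ is bad if $\omega_G(x)$ has at least two coordinates with value greater than $2$; for a bad vertex $x$, $k'(x)$ denotes the index of the second coordinate of $\omega_G(x)$ whose value is at least $3$. Finally $b(G)=\sum_{x \text{ bad}}\left(\lfloor\frac{n-1}{2}\rfloor-k'(x)\right)$, the sum over all bad vertices of $G$. -}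

module Defs where

open import Data.Bool using (Bool; true; false; _∧_; _∨_; not; if_then_else_)
open import Data.Bool.Properties using (∨-comm; ∧-zeroʳ)
open import Data.Nat using (ℕ; zero; suc; _+_; _∸_; _≡ᵇ_; _<ᵇ_; _/_; _≤_)
open import Data.Nat.ListAction using (sum)
open import Data.Bool.ListAction using (any)
open import Data.Product using (_×_)
open import Data.Fin using (Fin; toℕ)
open import Data.List using (List; []; _∷_; _++_; map; concatMap; filterᵇ; allFin; length)
open import Data.Integer using (ℤ; +_; _-_) renaming (_+_ to _+ℤ_)
open import Relation.Binary.PropositionalEquality using (_≡_; refl; cong; cong₂)

record Graph (n : ℕ) : Set where
  field
    adj    : Fin n → Fin n → Bool
    sym    : ∀ u v → adj u v ≡ adj v u
    irrefl : ∀ v → adj v v ≡ false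
open Graph public

private
  ≡ᵇ-sym : ∀ a b → (a ≡ᵇ b) ≡ (b ≡ᵇ a)
  ≡ᵇ-sym zero zero = refl
  ≡ᵇ-sym zero (suc b) = refl
  ≡ᵇ-sym (suc a) zero = refl
  ≡ᵇ-sym (suc a) (suc b) = ≡ᵇ-sym a b

  ≡ᵇ-refl : ∀ a → (a ≡ᵇ a) ≡ true
  ≡ᵇ-refl zero = refl
  ≡ᵇ-refl (suc a) = ≡ᵇ-refl a

fromRel : (n : ℕ) → (ℕ → ℕ → Bool) → Graph n
fromRel n E = record
  { adj    = λ u v → (E (toℕ u) (toℕ v) ∨ E (toℕ v) (toℕ u)) ∧ not (toℕ u ≡ᵇ toℕ v)
  ; sym    = λ u v → cong₂ _∧_ (∨-comm (E (toℕ u) (toℕ v)) (E (toℕ v) (toℕ u)))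
                                (cong not (≡ᵇ-sym (toℕ u) (toℕ v)))
  ; irrefl = λ v → helper (E (toℕ v) (toℕ v) ∨ E (toℕ v) (toℕ v)) (toℕ v)
  }
  where
  helper : ∀ b a → b ∧ not (a ≡ᵇ a) ≡ false
  helper b a rewrite ≡ᵇ-refl a = ∧-zeroʳ b

-- reachIn G P k u v = true iff there is a walk of length ≤ k from u to v
-- all of whose vertices satisfy P.
reachIn : ∀ {n} → Graph n → (Fin n → Bool) → ℕ → Fin n → Fin n → Bool
reachIn G P zero    u v = P u ∧ (toℕ u ≡ᵇ toℕ v)
reachIn {n} G P (suc k) u v =
  reachIn G P k u v ∨ (P u ∧ any (λ w → adj G u w ∧ reachIn G P k w v) (allFin n))

Connected : ∀ {n} → Graph n → Set
Connected {n} G = ∀ u v → reachIn G (λ _ → true) n u v ≡ true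

TwoConnected : ∀ {n} → Graph n → Set
TwoConnected {n} G =
  3 ≤ n × (Connected G ×
    (∀ (x u v : Fin n) → (toℕ u ≡ᵇ toℕ x) ≡ false → (toℕ v ≡ᵇ toℕ x) ≡ false →
       reachIn G (λ w → not (toℕ w ≡ᵇ toℕ x)) n u v ≡ true))

firstFrom : (ℕ → Bool) → ℕ → ℕ → ℕ
firstFrom f i zero       = i
firstFrom f i (suc fuel) = if f i then i else firstFrom f (suc i) fuel

dist : ∀ {n} → Graph n → Fin n → Fin n → ℕ
dist {n} G u v = firstFrom (λ k → reachIn G (λ _ → true) k u v) 0 n

W : ∀ {n} → Graph n → ℕ
W {n} G = sum (concatMap (λ u → map (λ v → dist G u v)
                 (filterᵇ (λ v → toℕ u <ᵇ toℕ v) (allFin n))) (allFin n))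

upFrom : ℕ → ℕ → List ℕ
upFrom s zero    = []
upFrom s (suc c) = s ∷ upFrom (suc s) c

countV : ∀ {n} → (Fin n → Bool) → ℕ
countV {n} P = length (filterᵇ P (allFin n))

ω : ∀ {n} → Graph n → Fin n → ℕ → ℕ
ω G v i = countV (λ x → dist G v x ≡ᵇ i)

bigIdx : ∀ {n} → Graph n → Fin n → List ℕ
bigIdx {n} G v = filterᵇ (λ i → 2 <ᵇ ω G v i) (upFrom 1 (n ∸ 1))

kv : ∀ {n} → Graph n → Fin n → ℕ
kv {n} G v with bigIdx G v
... | []    = n / 2
... | i ∷ _ = i

sumK : ∀ {n} → Graph n → ℕ
sumK {n} G = sum (map (kv G) (allFin n))

-- contribution of x to b(G): ⌊(n-1)/2⌋ - k'(x) if x is bad, else 0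
bContrib : ∀ {n} → Graph n → Fin n → ℤ
bContrib {n} G x with bigIdx G x
... | _ ∷ j ∷ _ = + ((n ∸ 1) / 2) - + j
... | _         = + 0

sumℤ : List ℤ → ℤ
sumℤ []       = + 0
sumℤ (z ∷ zs) = z +ℤ sumℤ zs

b : ∀ {n} → Graph n → ℤ
b {n} G = sumℤ (map (bContrib G) (allFin n))

-- H_{n,p,q}: end-vertices 0 and 1; internal vertices of the p-path are
-- 2,…,p; of the q-path p+1,…,p+q-1; of the (n-p-q+1)-path p+q,…,n-1.

consecutive : List ℕ → ℕ → ℕ → Bool
consecutive []           i j = false
consecutive (a ∷ [])     i j = false
consecutive (a ∷ c ∷ xs) i j = ((a ≡ᵇ i) ∧ (c ≡ᵇ j)) ∨ consecutive (c ∷ xs) i j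

pathThrough : ℕ → ℕ → List ℕ
pathThrough s c = 0 ∷ (upFrom s c ++ (1 ∷ []))

H : (n p q : ℕ) → Graph n
H n p q = fromRel n (λ i j →
     consecutive (pathThrough 2 (p ∸ 1)) i j
  ∨ (consecutive (pathThrough (p + 1) (q ∸ 1)) i j
  ∨  consecutive (pathThrough (p + q) (n ∸ p ∸ q)) i j))

module Submission where

open import Defs hiding (sym)
open import Data.Bool using (Bool; true; false; _∧_; _∨_; not; T; if_then_else_)
open import Data.Nat using (ℕ; zero; suc; _+_; _≡ᵇ_; _<ᵇ_; _≤ᵇ_; _≤_; _<_; z≤n; s≤s; _⊓_; _*_; _∸_; _/_)
open import Data.Nat.Properties
open import Data.Nat.ListAction using (sum)
open import Data.Bool.ListAction using (any)
open import Data.Product using (_×_; _,_; Σ; proj₁; proj₂)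
open import Data.Sum using (_⊎_; inj₁; inj₂; [_,_]′)
open import Data.Empty using (⊥-elim)
open import Data.Unit using (tt)
open import Data.Fin using (Fin; toℕ; fromℕ<) renaming (zero to fz; suc to fs; _≟_ to _≟F_)
open import Data.Fin.Properties using (toℕ-injective; toℕ<n; toℕ-fromℕ<) renaming (suc-injective to fs-injective)
open import Data.List using (List; []; _∷_; map; allFin; length; tabulate; filterᵇ; concatMap; _++_)
open import Data.List.Properties using (map-tabulate)
open import Data.List.Membership.Propositional using (_∈_)
open import Data.List.Relation.Unary.Any using (here; there)
open import Relation.Binary.PropositionalEquality
open import Relation.Nullary using (¬_; yes; no; Dec; does)
open import Relation.Binary using (tri<; tri≈; tri>)
open import Function using (_∘_; id; _∘′_)
open import Algebra.Properties.CommutativeSemigroup +-commutativeSemigroup using (interchange)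
open import Algebra.Properties.CommutativeMonoid.Sum +-0-commutativeMonoid using (∑-distrib-+; ∑-comm; sum-cong-≗; sum-replicate-zero) renaming (sum to ∑)
open import Data.List.Membership.Propositional.Properties using (∈-allFin)
open import Data.Nat.DivMod using (m*n/n≡m; /-monoˡ-≤; m/n*n≤m; m/n≤m)
open import Data.Nat.Tactic.RingSolver using (solve-∀)
open import Data.Integer using (ℤ) renaming (_-_ to _-ℤ_; +_ to ⁺_; _+_ to _+ℤ_; _<_ to _<ℤ_)
open import Data.Nat.ListAction.Properties using (sum-++)
import Data.Integer.Properties as ℤ
import Data.Integer.Tactic.RingSolver as ℤ-Solver
import Data.Sum

-- For a vertex v let T_i be the number of vertices farther than i from v, so that the
-- transmission σ(v) = Σ_x d(v, x) equals Σ_i T_i.  In a 2-connected graph every level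
-- 1, …, ecc(v) - 1 holds at least two vertices (a shortest path to a farther vertex and a path
-- avoiding its vertex on that level both cross the level), and the levels k(v) and k′(v) hold at
-- least three.  This bounds every T_i from above and gives
-- σ_G(v) + (⌊(n - 1)/2⌋ - k′(v)) ≤ σ₀ + k(v) for a bad vertex and σ_G(v) ≤ σ₀ + k(v) otherwise.
-- The graphs H_{n,1,2} and H_{n,2,2} are a cycle of length n - 1 plus an apex joined to two
-- vertices at distance one or two on it; at each vertex all levels hold at most two vertices
-- except one level K ≤ n/2 that may hold three, whence σ_H(v) ≥ σ₀ + k(v).  Summing over v,
-- 2W(G) ≤ nσ₀ + Σ k_G - b(G) < nσ₀ + Σ k_H ≤ 2W(H).

∨-true⁻¹ : ∀ {a b} → a ∨ b ≡ true → a ≡ true ⊎ b ≡ true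
∨-true⁻¹ {true} _ = inj₁ refl
∨-true⁻¹ {false} e = inj₂ e

∨-trueˡ : ∀ {a} b → a ≡ true → a ∨ b ≡ true
∨-trueˡ b refl = refl

∨-trueʳ : ∀ a {b} → b ≡ true → a ∨ b ≡ true
∨-trueʳ true _ = refl
∨-trueʳ false e = e

∧-true⁻¹ : ∀ {a b} → a ∧ b ≡ true → a ≡ true × b ≡ true
∧-true⁻¹ {true} {true} _ = refl , refl

∧-true : ∀ {a b} → a ≡ true → b ≡ true → a ∧ b ≡ true
∧-true refl refl = refl

≡ᵇ-refl : ∀ a → (a ≡ᵇ a) ≡ true
≡ᵇ-refl zero = refl
≡ᵇ-refl (suc a) = ≡ᵇ-refl a

≡ᵇ-true : ∀ {a b} → a ≡ b → (a ≡ᵇ b) ≡ true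
≡ᵇ-true {a} refl = ≡ᵇ-refl a

≡ᵇ-true⁻¹ : ∀ {a b} → (a ≡ᵇ b) ≡ true → a ≡ b
≡ᵇ-true⁻¹ {a} {b} e = ≡ᵇ⇒≡ a b (subst T (sym e) tt)

≡ᵇ-false : ∀ {a b} → ¬ a ≡ b → (a ≡ᵇ b) ≡ false
≡ᵇ-false {a} {b} a≢b with a ≡ᵇ b in e
... | true = ⊥-elim (a≢b (≡ᵇ-true⁻¹ e))
... | false = refl

≡ᵇ-false⁻¹ : ∀ {a b} → (a ≡ᵇ b) ≡ false → ¬ a ≡ b
≡ᵇ-false⁻¹ {a} e refl with () ← trans (sym (≡ᵇ-refl a)) e

<ᵇ-true : ∀ {i a} → i < a → (i <ᵇ a) ≡ true
<ᵇ-true {i} {a} i<a with i <ᵇ a | <⇒<ᵇ i<a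
... | true | _ = refl

<ᵇ-true⁻¹ : ∀ {i a} → (i <ᵇ a) ≡ true → i < a
<ᵇ-true⁻¹ {i} {a} e = <ᵇ⇒< i a (subst T (sym e) tt)

<ᵇ-false : ∀ {i a} → a ≤ i → (i <ᵇ a) ≡ false
<ᵇ-false {i} {a} a≤i with i <ᵇ a in e
... | false = refl
... | true = ⊥-elim (<⇒≱ (<ᵇ-true⁻¹ e) a≤i)

≤ᵇ-true : ∀ {p q} → p ≤ q → (p ≤ᵇ q) ≡ true
≤ᵇ-true {p} {q} p≤q with p ≤ᵇ q | ≤⇒≤ᵇ p≤q
... | true | _ = refl

≤ᵇ-false : ∀ {p q} → q < p → (p ≤ᵇ q) ≡ false
≤ᵇ-false {p} {q} q<p with p ≤ᵇ q in e
... | false = refl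
... | true = ⊥-elim (<⇒≱ q<p (≤ᵇ⇒≤ p q (subst T (sym e) tt)))

toℕ-≡ᵇ⇒≡ : ∀ {n} {u v : Fin n} → (toℕ u ≡ᵇ toℕ v) ≡ true → u ≡ v
toℕ-≡ᵇ⇒≡ e = toℕ-injective (≡ᵇ-true⁻¹ e)

any-true⁻¹ : ∀ {A : Set} (g : A → Bool) xs → any g xs ≡ true → Σ A λ x → g x ≡ true
any-true⁻¹ g (x ∷ xs) e with g x in gx
... | true = x , gx
... | false = any-true⁻¹ g xs e

any-true : ∀ {A : Set} (g : A → Bool) {xs} {x} → x ∈ xs → g x ≡ true → any g xs ≡ true
any-true g (here refl) gx rewrite gx = refl
any-true g {y ∷ _} (there x∈xs) gx = ∨-trueʳ (g y) (any-true g x∈xs gx)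

𝟙 : Bool → ℕ
𝟙 true = 1
𝟙 false = 0

𝟙≤1 : ∀ b → 𝟙 b ≤ 1
𝟙≤1 true = s≤s z≤n
𝟙≤1 false = z≤n

sum-tabulate : ∀ {n} (f : Fin n → ℕ) → sum (tabulate f) ≡ ∑ f
sum-tabulate {zero} f = refl
sum-tabulate {suc n} f = cong (f fz +_) (sum-tabulate (f ∘ fs))

sum-map-allFin : ∀ {n} (f : Fin n → ℕ) → sum (map f (allFin n)) ≡ ∑ f
sum-map-allFin f = trans (cong sum (map-tabulate id f)) (sum-tabulate f)

∑-mono-≤ : ∀ {n} {f g : Fin n → ℕ} → (∀ x → f x ≤ g x) → ∑ f ≤ ∑ g
∑-mono-≤ {zero} _ = z≤n
∑-mono-≤ {suc n} f≤g = +-mono-≤ (f≤g fz) (∑-mono-≤ (f≤g ∘ fs))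

∑-zero : ∀ n → ∑ {n} (λ _ → 0) ≡ 0
∑-zero = sum-replicate-zero

∑-one : ∀ n → ∑ {n} (λ _ → 1) ≡ n
∑-one zero = refl
∑-one (suc n) = cong suc (∑-one n)

∑< : ℕ → (ℕ → ℕ) → ℕ
∑< zero f = 0
∑< (suc n) f = ∑< n f + f n

∑<-cong : ∀ n {f g : ℕ → ℕ} → (∀ i → i < n → f i ≡ g i) → ∑< n f ≡ ∑< n g
∑<-cong zero _ = refl
∑<-cong (suc n) f≡g = cong₂ _+_ (∑<-cong n (λ i i<n → f≡g i (m≤n⇒m≤1+n i<n))) (f≡g n ≤-refl)

∑<-mono-≤ : ∀ n {f g : ℕ → ℕ} → (∀ i → i < n → f i ≤ g i) → ∑< n f ≤ ∑< n g
∑<-mono-≤ zero _ = z≤n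
∑<-mono-≤ (suc n) f≤g = +-mono-≤ (∑<-mono-≤ n (λ i i<n → f≤g i (m≤n⇒m≤1+n i<n))) (f≤g n ≤-refl)

∑<-distrib-+ : ∀ n (f g : ℕ → ℕ) → ∑< n (λ i → f i + g i) ≡ ∑< n f + ∑< n g
∑<-distrib-+ zero f g = refl
∑<-distrib-+ (suc n) f g = trans (cong (_+ (f n + g n)) (∑<-distrib-+ n f g)) (interchange (∑< n f) (∑< n g) (f n) (g n))

∑<-zero : ∀ n → ∑< n (λ _ → 0) ≡ 0
∑<-zero zero = refl
∑<-zero (suc n) = trans (+-identityʳ _) (∑<-zero n)

∑-∑<-comm : ∀ n k (g : Fin n → ℕ → ℕ) → ∑ (λ x → ∑< k (g x)) ≡ ∑< k (λ i → ∑ (λ x → g x i))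
∑-∑<-comm n zero g = ∑-zero n
∑-∑<-comm n (suc k) g =
  trans (∑-distrib-+ (λ x → ∑< k (g x)) (λ x → g x k)) (cong (_+ ∑ (λ x → g x k)) (∑-∑<-comm n k g))

∑<-𝟙-< : ∀ N a → ∑< N (λ i → 𝟙 (i <ᵇ a)) ≡ a ⊓ N
∑<-𝟙-< zero a = sym (⊓-zeroʳ a)
∑<-𝟙-< (suc N) a rewrite ∑<-𝟙-< N a with N <? a
... | yes N<a rewrite <ᵇ-true N<a | m≥n⇒m⊓n≡n (<⇒≤ N<a) | m≥n⇒m⊓n≡n N<a = +-comm N 1
... | no N≮a rewrite <ᵇ-false {N} {a} (≮⇒≥ N≮a) | m≤n⇒m⊓n≡m (≮⇒≥ N≮a) | m≤n⇒m⊓n≡m (m≤n⇒m≤1+n (≮⇒≥ N≮a)) = +-identityʳ a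

∑<-𝟙-<-≤ : ∀ N a → a ≤ N → ∑< N (λ i → 𝟙 (i <ᵇ a)) ≡ a
∑<-𝟙-<-≤ N a a≤N = trans (∑<-𝟙-< N a) (m≤n⇒m⊓n≡m a≤N)

∑<-𝟙-≡ : ∀ N k → ∑< N (λ t → 𝟙 (t ≡ᵇ k)) ≡ 𝟙 (k <ᵇ N)
∑<-𝟙-≡ zero k = refl
∑<-𝟙-≡ (suc N) k rewrite ∑<-𝟙-≡ N k with <-cmp k N
... | tri< k<N _ _ rewrite <ᵇ-true k<N | <ᵇ-true (m≤n⇒m≤1+n k<N) | ≡ᵇ-false {N} {k} (λ e → <-irrefl (sym e) k<N) = refl
... | tri≈ _ refl _ rewrite <ᵇ-false {k} {k} ≤-refl | <ᵇ-true (n<1+n k) | ≡ᵇ-refl k = refl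
... | tri> _ _ N<k rewrite <ᵇ-false {k} {N} (<⇒≤ N<k) | <ᵇ-false {k} {suc N} N<k | ≡ᵇ-false {N} {k} (λ e → <-irrefl e N<k) = refl

count : ∀ {n} → (Fin n → Bool) → ℕ
count P = ∑ (𝟙 ∘ P)

length-filterᵇ : ∀ {A : Set} (p : A → Bool) xs → length (filterᵇ p xs) ≡ sum (map (𝟙 ∘ p) xs)
length-filterᵇ p [] = refl
length-filterᵇ p (x ∷ xs) with p x
... | true = cong suc (length-filterᵇ p xs)
... | false = length-filterᵇ p xs

countV≡count : ∀ {n} (P : Fin n → Bool) → countV P ≡ count P
countV≡count {n} P = trans (length-filterᵇ P (allFin n)) (sum-map-allFin (𝟙 ∘ P))

AtMostOne : ∀ {n} → (Fin n → Bool) → Set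
AtMostOne P = ∀ x y → P x ≡ true → P y ≡ true → x ≡ y

count-≤1 : ∀ {n} (P : Fin n → Bool) → AtMostOne P → count P ≤ 1
count-≤1 {zero} P _ = z≤n
count-≤1 {suc n} P unique with P fz in P0
... | true = ≤-reflexive (cong suc (trans (sum-cong-≗ none) (∑-zero n)))
  where
  none : ∀ x → 𝟙 (P (fs x)) ≡ 0
  none x with P (fs x) in Px
  ... | true with () ← unique fz (fs x) P0 Px
  ... | false = refl
... | false = count-≤1 (P ∘ fs) (λ x y Px Py → fs-injective (unique (fs x) (fs y) Px Py))

1≤count : ∀ {n} (P : Fin n → Bool) x → P x ≡ true → 1 ≤ count P
1≤count P fz Px rewrite Px = s≤s z≤n
1≤count P (fs x) Px = ≤-trans (1≤count (P ∘ fs) x Px) (m≤n+m _ (𝟙 (P fz)))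

2≤count : ∀ {n} (P : Fin n → Bool) x y → P x ≡ true → P y ≡ true → ¬ x ≡ y → 2 ≤ count P
2≤count P fz fz _ _ x≢y = ⊥-elim (x≢y refl)
2≤count P fz (fs y) Px Py _ rewrite Px = s≤s (1≤count (P ∘ fs) y Py)
2≤count P (fs x) fz Px Py _ rewrite Py = s≤s (1≤count (P ∘ fs) x Px)
2≤count P (fs x) (fs y) Px Py x≢y =
  ≤-trans (2≤count (P ∘ fs) x y Px Py (x≢y ∘ cong fs)) (m≤n+m _ (𝟙 (P fz)))

count-witness : ∀ {n} (P : Fin n → Bool) → 0 < count P → Σ (Fin n) λ x → P x ≡ true
count-witness {suc n} P pos with P fz in P0
... | true = fz , P0
... | false with x , Px ← count-witness (P ∘ fs) pos = fs x , Px

count-none : ∀ {n} (P : Fin n → Bool) → (∀ x → P x ≡ false) → count P ≡ 0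
count-none {n} P none = trans (sum-cong-≗ (cong 𝟙 ∘ none)) (∑-zero n)

count-⊎₃ : ∀ {n} (P Q₁ Q₂ Q₃ : Fin n → Bool) →
  (∀ x → P x ≡ true → Q₁ x ≡ true ⊎ Q₂ x ≡ true ⊎ Q₃ x ≡ true) →
  count P ≤ count Q₁ + count Q₂ + count Q₃
count-⊎₃ P Q₁ Q₂ Q₃ covered = begin
    count P
  ≤⟨ ∑-mono-≤ pointwise ⟩
    ∑ (λ x → (𝟙 (Q₁ x) + 𝟙 (Q₂ x)) + 𝟙 (Q₃ x))
  ≡⟨ ∑-distrib-+ (λ x → 𝟙 (Q₁ x) + 𝟙 (Q₂ x)) (𝟙 ∘ Q₃) ⟩
    ∑ (λ x → 𝟙 (Q₁ x) + 𝟙 (Q₂ x)) + count Q₃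
  ≡⟨ cong (_+ count Q₃) (∑-distrib-+ (𝟙 ∘ Q₁) (𝟙 ∘ Q₂)) ⟩
    count Q₁ + count Q₂ + count Q₃ ∎
  where
  open ≤-Reasoning
  pointwise : ∀ x → 𝟙 (P x) ≤ 𝟙 (Q₁ x) + 𝟙 (Q₂ x) + 𝟙 (Q₃ x)
  pointwise x with P x in Px
  ... | false = z≤n
  ... | true with covered x Px
  ... | inj₁ q rewrite q = s≤s z≤n
  ... | inj₂ (inj₁ q) rewrite q = ≤-trans (m≤n+m 1 (𝟙 (Q₁ x))) (m≤m+n _ _)
  ... | inj₂ (inj₂ q) rewrite q = m≤n+m 1 _

count-≤2+𝟙 : ∀ {n} (P Q₁ Q₂ Q₃ : Fin n → Bool) b → AtMostOne Q₁ → AtMostOne Q₂ → AtMostOne Q₃ →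
  (∀ x → P x ≡ true → Q₁ x ≡ true ⊎ Q₂ x ≡ true ⊎ b ∧ Q₃ x ≡ true) → count P ≤ 2 + 𝟙 b
count-≤2+𝟙 P Q₁ Q₂ Q₃ b one₁ one₂ one₃ covered =
  ≤-trans (count-⊎₃ P Q₁ Q₂ (λ x → b ∧ Q₃ x) covered)
          (+-mono-≤ (+-mono-≤ (count-≤1 Q₁ one₁) (count-≤1 Q₂ one₂)) (guarded b))
  where
  guarded : ∀ b → count (λ x → b ∧ Q₃ x) ≤ 𝟙 b
  guarded true = count-≤1 Q₃ one₃
  guarded false = ≤-reflexive (count-none (λ x → false ∧ Q₃ x) (λ _ → refl))

-- Walks and distances

module _ {n} (G : Graph n) where

  reachIn-suc : ∀ P k u v → reachIn G P k u v ≡ true → reachIn G P (suc k) u v ≡ true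
  reachIn-suc P k u v r = ∨-trueˡ _ r

  reachIn-mono : ∀ P {k k′} u v → k ≤ k′ → reachIn G P k u v ≡ true → reachIn G P k′ u v ≡ true
  reachIn-mono P {k′ = zero} u v z≤n r = r
  reachIn-mono P {k} {suc k′} u v k≤1+k′ r with m≤n⇒m<n∨m≡n k≤1+k′
  ... | inj₂ refl = r
  ... | inj₁ (s≤s k≤k′) = reachIn-suc P k′ u v (reachIn-mono P u v k≤k′ r)

  reachIn-source : ∀ P k u v → reachIn G P k u v ≡ true → P u ≡ true
  reachIn-source P zero u v r = proj₁ (∧-true⁻¹ r)
  reachIn-source P (suc k) u v r with ∨-true⁻¹ {reachIn G P k u v} r
  ... | inj₁ r′ = reachIn-source P k u v r′
  ... | inj₂ r′ = proj₁ (∧-true⁻¹ r′)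

  reachIn-snoc : ∀ P k u x y → reachIn G P k u x ≡ true → adj G x y ≡ true → P y ≡ true →
                 reachIn G P (suc k) u y ≡ true
  reachIn-snoc P zero u x y r xy Py with Pu , u≡x ← ∧-true⁻¹ {P u} r with refl ← toℕ-≡ᵇ⇒≡ {n} {u} {x} u≡x =
    ∨-trueʳ (reachIn G P 0 u y) (∧-true Pu (any-true _ (∈-allFin y) (∧-true xy (∧-true Py (≡ᵇ-refl (toℕ y))))))
  reachIn-snoc P (suc k) u x y r xy Py with ∨-true⁻¹ {reachIn G P k u x} r
  ... | inj₁ r′ = reachIn-suc P (suc k) u y (reachIn-snoc P k u x y r′ xy Py)
  ... | inj₂ r′ with Pu , step ← ∧-true⁻¹ {P u} r′
                with w , uw∧r ← any-true⁻¹ _ (allFin n) step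
                with uw , r″ ← ∧-true⁻¹ {adj G u w} uw∧r =
    ∨-trueʳ (reachIn G P (suc k) u y) (∧-true Pu (any-true _ (∈-allFin w) (∧-true uw (reachIn-snoc P k w x y r″ xy Py))))

  reach-sym : ∀ k u v → reachIn G (λ _ → true) k u v ≡ true → reachIn G (λ _ → true) k v u ≡ true
  reach-sym zero u v r with refl ← toℕ-≡ᵇ⇒≡ {n} {u} {v} (proj₂ (∧-true⁻¹ {true} r)) = r
  reach-sym (suc k) u v r with ∨-true⁻¹ {reachIn G _ k u v} r
  ... | inj₁ r′ = reachIn-suc _ k v u (reach-sym k u v r′)
  ... | inj₂ r′ with w , uw∧r ← any-true⁻¹ _ (allFin n) (proj₂ (∧-true⁻¹ {true} r′))
                with uw , r″ ← ∧-true⁻¹ {adj G u w} uw∧r =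
    reachIn-snoc _ k v w u (reach-sym k w v r″) (trans (Graph.sym G w u) uw) refl

firstFrom-least : ∀ (f : ℕ → Bool) fuel i j → i ≤ j → f j ≡ true → firstFrom f i fuel ≤ j
firstFrom-least f zero i j i≤j _ = i≤j
firstFrom-least f (suc fuel) i j i≤j fj with f i in fi
... | true = i≤j
... | false with m≤n⇒m<n∨m≡n i≤j
... | inj₁ i<j = firstFrom-least f fuel (suc i) j i<j fj
... | inj₂ refl with () ← trans (sym fi) fj

firstFrom-≤ : ∀ (f : ℕ → Bool) fuel i → firstFrom f i fuel ≤ i + fuel
firstFrom-≤ f zero i = m≤m+n i 0
firstFrom-≤ f (suc fuel) i with f i
... | true = m≤m+n i _
... | false = ≤-trans (firstFrom-≤ f fuel (suc i)) (≤-reflexive (sym (+-suc i fuel)))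

firstFrom-holds : ∀ (f : ℕ → Bool) fuel i → f (i + fuel) ≡ true → f (firstFrom f i fuel) ≡ true
firstFrom-holds f zero i e rewrite +-identityʳ i = e
firstFrom-holds f (suc fuel) i e with f i in fi
... | true = fi
... | false = firstFrom-holds f fuel (suc i) (trans (cong f (sym (+-suc i fuel))) e)

module _ {n} (G : Graph n) where

  private
    reach : ℕ → Fin n → Fin n → Bool
    reach = reachIn G (λ _ → true)

  dist-≤ : ∀ j u v → reach j u v ≡ true → dist G u v ≤ j
  dist-≤ j u v r = firstFrom-least _ n 0 j z≤n r

  dist-≤-order : ∀ u v → dist G u v ≤ n
  dist-≤-order u v = firstFrom-≤ _ n 0

  dist-refl : ∀ v → dist G v v ≡ 0
  dist-refl v = n≤0⇒n≡0 (dist-≤ 0 v v (≡ᵇ-refl (toℕ v)))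

  module _ (connected : Connected G) where

    dist-reach : ∀ u v → reach (dist G u v) u v ≡ true
    dist-reach u v = firstFrom-holds (λ k → reach k u v) n 0 (connected u v)

    dist≡0⇒≡ : ∀ v x → dist G v x ≡ 0 → x ≡ v
    dist≡0⇒≡ v x d≡0 with dist-reach v x
    ... | r rewrite d≡0 = sym (toℕ-≡ᵇ⇒≡ (proj₂ (∧-true⁻¹ {true} r)))

    dist-sym : ∀ u v → dist G u v ≡ dist G v u
    dist-sym u v = ≤-antisym (dist-≤ (dist G v u) u v (reach-sym G (dist G v u) v u (dist-reach v u)))
                             (dist-≤ (dist G u v) v u (reach-sym G (dist G u v) u v (dist-reach u v)))

    dist-adj : ∀ v x y → adj G x y ≡ true → dist G v y ≤ suc (dist G v x)
    dist-adj v x y xy = dist-≤ _ v y (reachIn-snoc G _ (dist G v x) v x y (dist-reach v x) xy refl)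

    walk-meets-level : ∀ P k v u x t → reachIn G P k u x ≡ true → dist G v u ≤ t → t ≤ dist G v x →
                       Σ (Fin n) λ z → P z ≡ true × dist G v z ≡ t
    walk-meets-level P zero v u x t r u≤t t≤x with Pu , u≡x ← ∧-true⁻¹ {P u} r
                                            with refl ← toℕ-≡ᵇ⇒≡ {n} {u} {x} u≡x = u , Pu , ≤-antisym u≤t t≤x
    walk-meets-level P (suc k) v u x t r u≤t t≤x with ∨-true⁻¹ {reachIn G P k u x} r
    ... | inj₁ r′ = walk-meets-level P k v u x t r′ u≤t t≤x
    ... | inj₂ r′ with Pu , step ← ∧-true⁻¹ {P u} r′
                  with w , uw∧r ← any-true⁻¹ _ (allFin n) step
                  with uw , r″ ← ∧-true⁻¹ {adj G u w} uw∧r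
                  with m≤n⇒m<n∨m≡n u≤t
    ... | inj₂ u≡t = u , Pu , u≡t
    ... | inj₁ u<t = walk-meets-level P k v w x t r″ (≤-trans (dist-adj v u w uw) u<t) t≤x

  module DistanceFromPotential (v : Fin n) (f : Fin n → ℕ) (f-zero : f v ≡ 0) (f≡0⇒≡ : ∀ x → f x ≡ 0 → x ≡ v)
           (f-adj : ∀ x y → adj G x y ≡ true → f y ≤ suc (f x))
           (f-descent : ∀ x t → f x ≡ suc t → Σ (Fin n) λ y → adj G y x ≡ true × f y ≡ t)
           (f≤n : ∀ x → f x ≤ n) where

    potential-reach : ∀ t x → f x ≡ t → reach t v x ≡ true
    potential-reach zero x fx≡0 with refl ← f≡0⇒≡ x fx≡0 = ≡ᵇ-refl (toℕ x)
    potential-reach (suc t) x fx≡1+t with y , yx , fy≡t ← f-descent x t fx≡1+t =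
      reachIn-snoc G _ t v y x (potential-reach t y fy≡t) yx refl

    potential-≤-walk : ∀ k u x → reach k u x ≡ true → f x ≤ k + f u
    potential-≤-walk zero u x r with refl ← toℕ-≡ᵇ⇒≡ {n} {u} {x} (proj₂ (∧-true⁻¹ {true} r)) = ≤-refl
    potential-≤-walk (suc k) u x r with ∨-true⁻¹ {reach k u x} r
    ... | inj₁ r′ = ≤-trans (potential-≤-walk k u x r′) (+-monoˡ-≤ (f u) (n≤1+n k))
    ... | inj₂ r′ with w , uw∧r ← any-true⁻¹ _ (allFin n) (proj₂ (∧-true⁻¹ {true} r′))
                  with uw , r″ ← ∧-true⁻¹ {adj G u w} uw∧r =
      ≤-trans (potential-≤-walk k w x r″) (≤-trans (+-monoʳ-≤ k (f-adj u w uw)) (≤-reflexive (+-suc k (f u))))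

    potential-connects : ∀ x → reach n v x ≡ true
    potential-connects x = reachIn-mono G _ v x (f≤n x) (potential-reach (f x) x refl)

    dist≡potential : ∀ x → dist G v x ≡ f x
    dist≡potential x = ≤-antisym (dist-≤ _ v x (potential-reach (f x) x refl)) (begin
        f x                 ≤⟨ potential-≤-walk _ v x (firstFrom-holds (λ k → reach k v x) n 0 (potential-connects x)) ⟩
        dist G v x + f v    ≡⟨ cong (dist G v x +_) f-zero ⟩
        dist G v x + 0      ≡⟨ +-identityʳ _ ⟩
        dist G v x          ∎)
      where open ≤-Reasoning

-- Distance levels and transmission bounds

module Layers {n} (d : Fin n → ℕ) where

  beyond : ℕ → ℕ
  beyond i = count (λ x → i <ᵇ d x)

  layer : ℕ → ℕ
  layer t = count (λ x → d x ≡ᵇ t)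

  ∑≡∑<-beyond : ∀ N → (∀ x → d x ≤ N) → ∑ d ≡ ∑< N beyond
  ∑≡∑<-beyond N d≤N = trans (sum-cong-≗ (λ x → sym (∑<-𝟙-<-≤ N (d x) (d≤N x))))
                            (∑-∑<-comm n N (λ x i → 𝟙 (i <ᵇ d x)))

  beyond+layers : ∀ i → beyond i + ∑< (suc i) layer ≡ n
  beyond+layers zero = trans (sym (∑-distrib-+ (λ x → 𝟙 (0 <ᵇ d x)) (λ x → 𝟙 (d x ≡ᵇ 0)))) (trans (sum-cong-≗ (λ x → split (d x))) (∑-one n))
    where
    split : ∀ a → 𝟙 (0 <ᵇ a) + 𝟙 (a ≡ᵇ 0) ≡ 1
    split zero = refl
    split (suc a) = refl
  beyond+layers (suc i) = begin
      beyond (suc i) + (∑< (suc i) layer + layer (suc i))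
    ≡⟨ cong (beyond (suc i) +_) (+-comm (∑< (suc i) layer) _) ⟩
      beyond (suc i) + (layer (suc i) + ∑< (suc i) layer)
    ≡⟨ sym (+-assoc (beyond (suc i)) _ _) ⟩
      (beyond (suc i) + layer (suc i)) + ∑< (suc i) layer
    ≡⟨ cong (_+ ∑< (suc i) layer) (trans (sym (∑-distrib-+ (λ x → 𝟙 (suc i <ᵇ d x)) (λ x → 𝟙 (d x ≡ᵇ suc i)))) (sum-cong-≗ (λ x → sym (split i (d x))))) ⟩
      beyond i + ∑< (suc i) layer
    ≡⟨ beyond+layers i ⟩
      n ∎
    where
    open ≡-Reasoning
    split : ∀ i a → 𝟙 (i <ᵇ a) ≡ 𝟙 (suc i <ᵇ a) + 𝟙 (a ≡ᵇ suc i)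
    split zero zero = refl
    split zero (suc zero) = refl
    split zero (suc (suc a)) = refl
    split (suc i) zero = refl
    split (suc i) (suc a) = split i a

-- σ₀ N + ⌊n/2⌋ is the transmission of a vertex of the cycle on n = N + 2 vertices.
σ₀ : ℕ → ℕ
σ₀ N = ∑< (suc (suc N)) (λ i → N ∸ 2 * i)

∑<-σ₀-+ : ∀ N K → K ≤ suc (suc N) → ∑< (suc (suc N)) (λ i → N ∸ 2 * i + 𝟙 (i <ᵇ K)) ≡ σ₀ N + K
∑<-σ₀-+ N K K≤n = trans (∑<-distrib-+ (suc (suc N)) _ _) (cong (σ₀ N +_) (∑<-𝟙-<-≤ (suc (suc N)) K K≤n))

*2≤⇒≤/2 : ∀ a N → 2 * a ≤ N → a ≤ N / 2
*2≤⇒≤/2 a N 2a≤N = ≤-trans (≤-reflexive (sym (m*n/n≡m a 2))) (/-monoˡ-≤ 2 (≤-trans (≤-reflexive (*-comm a 2)) 2a≤N))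

≤/2⇒*2≤ : ∀ a N → a ≤ N / 2 → 2 * a ≤ N
≤/2⇒*2≤ a N a≤N/2 = ≤-trans (≤-reflexive (*-comm 2 a)) (≤-trans (*-monoˡ-≤ 2 a≤N/2) (m/n*n≤m N 2))

2*-suc : ∀ i → 2 * suc i ≡ suc (suc (2 * i))
2*-suc = solve-∀

∸-suc : ∀ a N → a ≤ N → suc N ∸ a ≡ suc (N ∸ a)
∸-suc zero N _ = refl
∸-suc (suc a) (suc N) (s≤s a≤N) = ∸-suc a N a≤N

-- In the bounds below T is the number of vertices beyond level i; the hypothesis says that the
-- levels 0, …, i hold at least 1 + 2i vertices plus one for each big level k, k′ among them.

private
  beyond-shell : ∀ T i x N → suc T + (1 + 2 * i + x) ≤ suc (suc N) → T + x ≤ N ∸ 2 * i × 2 * i ≤ N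
  beyond-shell T i x N le = m+n≤o⇒m≤o∸n (T + x) le′ , m+n≤o⇒n≤o (T + x) le′
    where
    reorder : ∀ T i x → suc T + (1 + 2 * i + x) ≡ suc (suc ((T + x) + 2 * i))
    reorder = solve-∀
    le′ : (T + x) + 2 * i ≤ N
    le′ = ≤-pred (≤-pred (≤-trans (≤-reflexive (sym (reorder T i x))) le))

  +0≤⇒1+≤ : ∀ T R → T + 0 ≤ R → T + 1 ≤ R + 1
  +0≤⇒1+≤ T R le = +-monoˡ-≤ 1 (≤-trans (≤-reflexive (sym (+-identityʳ T))) le)

beyond-bound₀ : ∀ T i N → T ≡ 0 ⊎ T + (1 + 2 * i + 0) ≤ suc (suc N) →
                T ≤ N ∸ 2 * i + 𝟙 (i <ᵇ suc (suc N) / 2)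
beyond-bound₀ zero i N _ = z≤n
beyond-bound₀ (suc T) i N (inj₂ le) with T+0≤R , 2i≤N ← beyond-shell T i 0 N le
  rewrite <ᵇ-true {i} {suc (suc N) / 2} (*2≤⇒≤/2 (suc i) (suc (suc N)) (≤-trans (≤-reflexive (2*-suc i)) (s≤s (s≤s 2i≤N)))) =
  ≤-trans (≤-reflexive (+-comm 1 T)) (+0≤⇒1+≤ T _ T+0≤R)

beyond-bound₁ : ∀ T i k N → T ≡ 0 ⊎ T + (1 + 2 * i + 𝟙 (k <ᵇ suc i)) ≤ suc (suc N) →
                T ≤ N ∸ 2 * i + 𝟙 (i <ᵇ k)
beyond-bound₁ zero i k N _ = z≤n
beyond-bound₁ (suc T) i k N (inj₂ le) with i <? k
... | yes i<k rewrite <ᵇ-false {k} {suc i} i<k | <ᵇ-true i<k with T+0≤R , _ ← beyond-shell T i 0 N le =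
  ≤-trans (≤-reflexive (+-comm 1 T)) (+0≤⇒1+≤ T _ T+0≤R)
... | no i≮k rewrite <ᵇ-true {k} {suc i} (s≤s (≮⇒≥ i≮k)) | <ᵇ-false {i} {k} (≮⇒≥ i≮k) with T+1≤R , _ ← beyond-shell T i 1 N le =
  ≤-trans (≤-reflexive (+-comm 1 T)) (≤-trans T+1≤R (≤-reflexive (sym (+-identityʳ _))))

beyond-bound₂ : ∀ T i k k′ N → 1 ≤ k → k < k′ →
                T ≡ 0 ⊎ T + (1 + 2 * i + (𝟙 (k <ᵇ suc i) + 𝟙 (k′ <ᵇ suc i))) ≤ suc (suc N) →
                T + 𝟙 (i <ᵇ suc N / 2) ≤ N ∸ 2 * i + 𝟙 (i <ᵇ k) + 𝟙 (i <ᵇ k′)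
beyond-bound₂ zero i k k′ N _ _ _ with i <? suc N / 2
... | no i≮ rewrite <ᵇ-false {i} {suc N / 2} (≮⇒≥ i≮) = z≤n
... | yes i< rewrite <ᵇ-true i< = ≤-trans (m<n⇒0<n∸m 2i<N) (≤-trans (m≤m+n _ _) (m≤m+n _ _))
  where
  2i<N : 2 * i < N
  2i<N = ≤-pred (≤-trans (≤-reflexive (sym (2*-suc i))) (≤/2⇒*2≤ (suc i) (suc N) i<))
beyond-bound₂ (suc T) i k k′ N _ k<k′ (inj₂ le) =
  ≤-trans (+-monoʳ-≤ (suc T) (𝟙≤1 (i <ᵇ suc N / 2))) (bound (i <? k) (i <? k′))
  where
  open ≤-Reasoning
  bound : Dec (i < k) → Dec (i < k′) → suc T + 1 ≤ N ∸ 2 * i + 𝟙 (i <ᵇ k) + 𝟙 (i <ᵇ k′)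
  bound (yes i<k) _ rewrite <ᵇ-false {k} {suc i} i<k | <ᵇ-false {k′} {suc i} (≤-trans i<k (<⇒≤ k<k′))
                           | <ᵇ-true i<k | <ᵇ-true (<-trans i<k k<k′) with T+0≤R , _ ← beyond-shell T i 0 N le = begin
    suc T + 1           ≡⟨ +-comm (suc T) 1 ⟩
    suc (suc T)         ≡⟨ cong (λ t → suc (suc t)) (+-identityʳ T) ⟨
    suc (suc (T + 0))   ≤⟨ s≤s (s≤s T+0≤R) ⟩
    suc (suc (N ∸ 2 * i)) ≡⟨ +-comm 2 (N ∸ 2 * i) ⟩
    N ∸ 2 * i + 2         ≡⟨ +-assoc (N ∸ 2 * i) 1 1 ⟨
    N ∸ 2 * i + 1 + 1   ∎
  bound (no i≮k) (yes i<k′) rewrite <ᵇ-true {k} {suc i} (s≤s (≮⇒≥ i≮k)) | <ᵇ-false {k′} {suc i} i<k′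
                                  | <ᵇ-false {i} {k} (≮⇒≥ i≮k) | <ᵇ-true i<k′ with T+1≤R , _ ← beyond-shell T i 1 N le = begin
    suc T + 1       ≡⟨ +-comm (suc T) 1 ⟩
    suc (suc T)     ≡⟨ cong suc (+-comm 1 T) ⟩
    suc (T + 1)     ≤⟨ s≤s T+1≤R ⟩
    suc (N ∸ 2 * i) ≡⟨ +-comm 1 _ ⟩
    N ∸ 2 * i + 1   ≡⟨ cong (_+ 1) (sym (+-identityʳ _)) ⟩
    N ∸ 2 * i + 0 + 1 ∎
  bound (no i≮k) (no i≮k′) rewrite <ᵇ-true {k} {suc i} (s≤s (≮⇒≥ i≮k)) | <ᵇ-true {k′} {suc i} (s≤s (≮⇒≥ i≮k′))
                                 | <ᵇ-false {i} {k} (≮⇒≥ i≮k) | <ᵇ-false {i} {k′} (≮⇒≥ i≮k′) with T+2≤R , _ ← beyond-shell T i 2 N le = begin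
    suc T + 1         ≡⟨ sym (+-suc T 1) ⟩
    T + 2             ≤⟨ T+2≤R ⟩
    N ∸ 2 * i         ≡⟨ sym (trans (+-identityʳ _) (+-identityʳ _)) ⟩
    N ∸ 2 * i + 0 + 0 ∎

-- Conversely, the right-hand sides below are n minus the largest possible size of the levels
-- 0, …, i when only level K may hold three vertices.

private
  <-half⇒2*≤ : ∀ i N → i < suc (suc N) / 2 → 2 * i ≤ N
  <-half⇒2*≤ i N i< = ≤-pred (≤-pred (≤-trans (≤-reflexive (sym (2*-suc i))) (≤/2⇒*2≤ (suc i) (suc (suc N)) i<)))

  <⇒2*≤ : ∀ i K N → i < K → 2 * K ≤ suc (suc N) → 2 * i ≤ N
  <⇒2*≤ i K N i<K 2K≤n = ≤-pred (≤-pred (≤-trans (≤-reflexive (sym (2*-suc i))) (≤-trans (*-monoʳ-≤ 2 i<K) 2K≤n)))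

beyond-lower₀ : ∀ i N → N ∸ 2 * i + 𝟙 (i <ᵇ suc (suc N) / 2) ≤ suc (suc N) ∸ (1 + 2 * i + 0)
beyond-lower₀ i N rewrite +-identityʳ (2 * i) with i <? suc (suc N) / 2
... | yes i< rewrite <ᵇ-true i< | ∸-suc (2 * i) N (<-half⇒2*≤ i N i<) = ≤-reflexive (+-comm _ 1)
... | no i≮ rewrite <ᵇ-false {i} {suc (suc N) / 2} (≮⇒≥ i≮) =
  ≤-trans (≤-reflexive (+-identityʳ _)) (∸-monoˡ-≤ (2 * i) (n≤1+n N))

beyond-lower₁ : ∀ i K N → 2 * K ≤ suc (suc N) →
                N ∸ 2 * i + 𝟙 (i <ᵇ K) ≤ suc (suc N) ∸ (1 + 2 * i + 𝟙 (K <ᵇ suc i))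
beyond-lower₁ i K N 2K≤n with i <? K
... | yes i<K rewrite <ᵇ-true i<K | <ᵇ-false {K} {suc i} i<K | +-identityʳ (2 * i) | ∸-suc (2 * i) N (<⇒2*≤ i K N i<K 2K≤n) = ≤-reflexive (+-comm _ 1)
... | no i≮K rewrite <ᵇ-false {i} {K} (≮⇒≥ i≮K) | <ᵇ-true {K} {suc i} (s≤s (≮⇒≥ i≮K)) | +-comm (2 * i) 1 = ≤-reflexive (+-identityʳ _)

module _ {n} (G : Graph n) (v : Fin n) where

  kv-∷ : ∀ {k ks} → bigIdx G v ≡ k ∷ ks → kv G v ≡ k
  kv-∷ e rewrite e = refl

  kv-[] : bigIdx G v ≡ [] → kv G v ≡ n / 2
  kv-[] e rewrite e = refl

  bContrib-∷∷ : ∀ {k k′ ks} → bigIdx G v ≡ k ∷ k′ ∷ ks → bContrib G v ≡ ⁺ ((n ∸ 1) / 2) -ℤ ⁺ k′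
  bContrib-∷∷ e rewrite e = refl

  bContrib-[-] : ∀ {k} → bigIdx G v ≡ k ∷ [] → bContrib G v ≡ ⁺ 0
  bContrib-[-] e rewrite e = refl

  bContrib-[] : bigIdx G v ≡ [] → bContrib G v ≡ ⁺ 0
  bContrib-[] e rewrite e = refl

module FilterUpFrom (p : ℕ → Bool) where

  filter-upFrom-∷ : ∀ c s k ks → filterᵇ p (upFrom s c) ≡ k ∷ ks →
    p k ≡ true × s ≤ k × k < s + c ×
    Σ ℕ λ s′ → Σ ℕ λ c′ → ks ≡ filterᵇ p (upFrom s′ c′) × suc k ≤ s′ × s′ + c′ ≡ s + c
  filter-upFrom-∷ (suc c) s k ks e with p s in ps
  filter-upFrom-∷ (suc c) s k ks refl | true = ps , ≤-refl , m<m+n s (s≤s z≤n) , suc s , c , refl , ≤-refl , sym (+-suc s c)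
  ... | false with pk , s<k , k<end , s′ , c′ , ks≡ , k<s′ , end≡ ← filter-upFrom-∷ c (suc s) k ks e =
    pk , <⇒≤ s<k , ≤-trans k<end (≤-reflexive (sym (+-suc s c))) , s′ , c′ , ks≡ , k<s′ , trans end≡ (sym (+-suc s c))

  filter-upFrom-least : ∀ c s k ks → filterᵇ p (upFrom s c) ≡ k ∷ ks →
                        ∀ i → s ≤ i → i < s + c → p i ≡ true → k ≤ i
  filter-upFrom-least (suc c) s k ks e i s≤i i<end pi with p s in ps
  filter-upFrom-least (suc c) s k ks refl i s≤i i<end pi | true = s≤i
  ... | false with m≤n⇒m<n∨m≡n s≤i
  ... | inj₂ refl with () ← trans (sym ps) pi
  ... | inj₁ s<i = filter-upFrom-least c (suc s) k ks e i s<i (≤-trans i<end (≤-reflexive (+-suc s c))) pi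

  filter-upFrom-[] : ∀ c s → filterᵇ p (upFrom s c) ≡ [] → ∀ i → s ≤ i → i < s + c → p i ≡ false
  filter-upFrom-[] zero s e i s≤i i<end = ⊥-elim (<⇒≱ i<end (≤-trans (≤-reflexive (+-identityʳ s)) s≤i))
  filter-upFrom-[] (suc c) s e i s≤i i<end with p s in ps
  filter-upFrom-[] (suc c) s () i s≤i i<end | true
  ... | false with m≤n⇒m<n∨m≡n s≤i
  ... | inj₂ refl = ps
  ... | inj₁ s<i = filter-upFrom-[] c (suc s) e i s<i (≤-trans i<end (≤-reflexive (+-suc s c)))

  filter-upFrom-[]-intro : ∀ c s → (∀ i → s ≤ i → i < s + c → p i ≡ false) → filterᵇ p (upFrom s c) ≡ []
  filter-upFrom-[]-intro zero s _ = refl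
  filter-upFrom-[]-intro (suc c) s none rewrite none s ≤-refl (m<m+n s (s≤s z≤n)) =
    filter-upFrom-[]-intro c (suc s) (λ i s<i i<end → none i (<⇒≤ s<i) (≤-trans i<end (≤-reflexive (sym (+-suc s c)))))

-- The least size of level t when intermediate levels have two vertices and e marks big levels.
levelFloor : (ℕ → ℕ) → ℕ → ℕ
levelFloor e zero = 1
levelFloor e (suc t) = 2 + e (suc t)

∑<-levelFloor : ∀ e → e 0 ≡ 0 → ∀ i → ∑< (suc i) (levelFloor e) ≡ 1 + 2 * i + ∑< (suc i) e
∑<-levelFloor e e0 zero rewrite e0 = refl
∑<-levelFloor e e0 (suc i) rewrite ∑<-levelFloor e e0 i = reorder i (∑< (suc i) e) (e (suc i))
  where
  reorder : ∀ i a b → 1 + 2 * i + a + (2 + b) ≡ 1 + 2 * suc i + (a + b)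
  reorder = solve-∀

module TwoConnectedVertex {N : ℕ} (G : Graph (suc (suc N))) (two-connected : TwoConnected G) (v : Fin (suc (suc N))) where

  private
    n : ℕ
    n = suc (suc N)
    connected : Connected G
    connected = proj₁ (proj₂ two-connected)

  open Layers (dist G v) public

  1≤layer-0 : 1 ≤ layer 0
  1≤layer-0 = 1≤count (λ w → dist G v w ≡ᵇ 0) v (cong (_≡ᵇ 0) (dist-refl G v))

  -- A shortest walk from v to x meets level t in some y, and a walk from v to x avoiding y
  -- (there is one, since y is not a cut vertex) meets level t in a second vertex.
  2≤layer : ∀ t x → 1 ≤ t → t < dist G v x → 2 ≤ layer t
  2≤layer t x 1≤t t<x
    with y , _ , y-at-t ← walk-meets-level G connected _ n v v x t (connected v x) (≤-trans (≤-reflexive (dist-refl G v)) z≤n) (<⇒≤ t<x) =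
    let z , z≢y , z-at-t = walk-meets-level G connected _ n v v x t (proj₂ (proj₂ two-connected) y v x (≡ᵇ-false v≢y) (≡ᵇ-false x≢y))
                                            (≤-trans (≤-reflexive (dist-refl G v)) z≤n) (<⇒≤ t<x)
    in 2≤count (λ w → dist G v w ≡ᵇ t) y z (≡ᵇ-true y-at-t) (≡ᵇ-true z-at-t) (y≢z z z≢y)
    where
    v≢y : ¬ toℕ v ≡ toℕ y
    v≢y e with refl ← toℕ-injective e = <⇒≱ 1≤t (≤-reflexive (trans (sym y-at-t) (dist-refl G v)))
    x≢y : ¬ toℕ x ≡ toℕ y
    x≢y e with refl ← toℕ-injective e = <-irrefl (sym y-at-t) t<x
    y≢z : ∀ z → not (toℕ z ≡ᵇ toℕ y) ≡ true → ¬ y ≡ z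
    y≢z z z≢y refl rewrite ≡ᵇ-refl (toℕ y) with () ← z≢y

  beyond-≤ : (e : ℕ → ℕ) → e 0 ≡ 0 → (∀ t → e t ≤ 1) → (∀ t → 1 ≤ e t → 3 ≤ layer t) →
             ∀ i → beyond i ≡ 0 ⊎ beyond i + (1 + 2 * i + ∑< (suc i) e) ≤ n
  beyond-≤ e e0 e≤1 big i with beyond i in eq
  ... | zero = inj₁ refl
  ... | suc T with x , i<x ← count-witness (λ x → i <ᵇ dist G v x) (≤-trans (s≤s z≤n) (≤-reflexive (sym eq))) = inj₂ (begin
        suc T + (1 + 2 * i + ∑< (suc i) e)
      ≡⟨ cong₂ _+_ (sym eq) (sym (∑<-levelFloor e e0 i)) ⟩
        beyond i + ∑< (suc i) (levelFloor e)
      ≤⟨ +-monoʳ-≤ (beyond i) (∑<-mono-≤ (suc i) floor≤layer) ⟩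
        beyond i + ∑< (suc i) layer
      ≡⟨ beyond+layers i ⟩
        n ∎)
    where
    open ≤-Reasoning
    floor≤layer : ∀ t → t < suc i → levelFloor e t ≤ layer t
    floor≤layer zero _ = 1≤layer-0
    floor≤layer (suc t) t<1+i with e (suc t) in et | e≤1 (suc t)
    ... | zero | _ = 2≤layer (suc t) x (s≤s z≤n) (≤-<-trans (≤-pred t<1+i) (<ᵇ-true⁻¹ i<x))
    ... | suc zero | _ = big (suc t) (≤-reflexive (sym et))
    ... | suc (suc _) | s≤s ()

  -- ⁺ B₁ -ℤ ⁺ B₂ is the contribution ⌊(n - 1)/2⌋ - k′(v) of v to b(G), or 0 if v is not bad.
  TransmissionBound : Set
  TransmissionBound = Σ ℕ λ B₁ → Σ ℕ λ B₂ → bContrib G v ≡ ⁺ B₁ -ℤ ⁺ B₂ × ∑ (dist G v) + B₁ ≤ σ₀ N + kv G v + B₂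

  private
    σ≡∑<-beyond : ∑ (dist G v) ≡ ∑< n beyond
    σ≡∑<-beyond = ∑≡∑<-beyond n (dist-≤-order G v)

    big : ∀ k → (2 <ᵇ ω G v k) ≡ true → 3 ≤ layer k
    big k e = ≤-trans (<ᵇ-true⁻¹ e) (≤-reflexive (countV≡count (λ x → dist G v x ≡ᵇ k)))

    𝟙≡-pos : ∀ {t k} → 1 ≤ 𝟙 (t ≡ᵇ k) → t ≡ k
    𝟙≡-pos {t} {k} le with t ≡ᵇ k in e
    ... | true = ≡ᵇ-true⁻¹ e

  open FilterUpFrom (λ i → 2 <ᵇ ω G v i)

  transmission-≤-no-big : bigIdx G v ≡ [] → TransmissionBound
  transmission-≤-no-big eq = 0 , 0 , bContrib-[] G v eq , (begin
      ∑ (dist G v) + 0                          ≡⟨ trans (+-identityʳ _) σ≡∑<-beyond ⟩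
      ∑< n beyond                               ≤⟨ ∑<-mono-≤ n (λ i _ → beyond-bound₀ (beyond i) i N (bound i)) ⟩
      ∑< n (λ i → N ∸ 2 * i + 𝟙 (i <ᵇ n / 2))   ≡⟨ ∑<-σ₀-+ N (n / 2) (m/n≤m n 2) ⟩
      σ₀ N + n / 2                              ≡⟨ cong (σ₀ N +_) (sym (kv-[] G v eq)) ⟩
      σ₀ N + kv G v                             ≡⟨ sym (+-identityʳ _) ⟩
      σ₀ N + kv G v + 0                         ∎)
    where
    open ≤-Reasoning
    bound : ∀ i → beyond i ≡ 0 ⊎ beyond i + (1 + 2 * i + 0) ≤ n
    bound i = Data.Sum.map₂ (subst (λ s → beyond i + (1 + 2 * i + s) ≤ n) (∑<-zero (suc i)))
                            (beyond-≤ (λ _ → 0) refl (λ _ → z≤n) (λ _ ()) i)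

  transmission-≤-one-big : ∀ {k} → bigIdx G v ≡ k ∷ [] → TransmissionBound
  transmission-≤-one-big {k} eq with k-big , 1≤k , k<n , _ ← filter-upFrom-∷ (n ∸ 1) 1 k [] eq = 0 , 0 , bContrib-[-] G v eq , (begin
      ∑ (dist G v) + 0                        ≡⟨ trans (+-identityʳ _) σ≡∑<-beyond ⟩
      ∑< n beyond                             ≤⟨ ∑<-mono-≤ n (λ i _ → beyond-bound₁ (beyond i) i k N (bound i)) ⟩
      ∑< n (λ i → N ∸ 2 * i + 𝟙 (i <ᵇ k))     ≡⟨ ∑<-σ₀-+ N k (<⇒≤ k<n) ⟩
      σ₀ N + k                                ≡⟨ cong (σ₀ N +_) (sym (kv-∷ G v eq)) ⟩
      σ₀ N + kv G v                           ≡⟨ sym (+-identityʳ _) ⟩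
      σ₀ N + kv G v + 0                       ∎)
    where
    open ≤-Reasoning
    bound : ∀ i → beyond i ≡ 0 ⊎ beyond i + (1 + 2 * i + 𝟙 (k <ᵇ suc i)) ≤ n
    bound i = Data.Sum.map₂ (subst (λ s → beyond i + (1 + 2 * i + s) ≤ n) (∑<-𝟙-≡ (suc i) k))
                (beyond-≤ (λ t → 𝟙 (t ≡ᵇ k)) (cong 𝟙 (≡ᵇ-false (<⇒≢ 1≤k))) (λ _ → 𝟙≤1 _)
                          (λ t le → subst (λ t → 3 ≤ layer t) (sym (𝟙≡-pos le)) (big k k-big)) i)

  transmission-≤-two-big : ∀ {k k′ ks} → bigIdx G v ≡ k ∷ k′ ∷ ks → TransmissionBound
  transmission-≤-two-big {k} {k′} {ks} eq
    with k-big , 1≤k , k<n , s′ , c′ , rest , k<s′ , end≡ ← filter-upFrom-∷ (n ∸ 1) 1 k (k′ ∷ ks) eq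
    with k′-big , s′≤k′ , k′<end , _ ← filter-upFrom-∷ c′ s′ k′ ks (sym rest) = (suc N) / 2 , k′ , bContrib-∷∷ G v eq , (begin
      ∑ (dist G v) + M
    ≡⟨ cong₂ _+_ σ≡∑<-beyond (sym (∑<-𝟙-<-≤ n M M≤n)) ⟩
      ∑< n beyond + ∑< n (λ i → 𝟙 (i <ᵇ M))
    ≡⟨ sym (∑<-distrib-+ n _ _) ⟩
      ∑< n (λ i → beyond i + 𝟙 (i <ᵇ M))
    ≤⟨ ∑<-mono-≤ n (λ i _ → beyond-bound₂ (beyond i) i k k′ N 1≤k k<k′ (bound i)) ⟩
      ∑< n (λ i → N ∸ 2 * i + 𝟙 (i <ᵇ k) + 𝟙 (i <ᵇ k′))
    ≡⟨ ∑<-distrib-+ n _ _ ⟩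
      ∑< n (λ i → N ∸ 2 * i + 𝟙 (i <ᵇ k)) + ∑< n (λ i → 𝟙 (i <ᵇ k′))
    ≡⟨ cong₂ _+_ (∑<-σ₀-+ N k (<⇒≤ k<n)) (∑<-𝟙-<-≤ n k′ k′≤n) ⟩
      σ₀ N + k + k′
    ≡⟨ cong (λ w → σ₀ N + w + k′) (sym (kv-∷ G v eq)) ⟩
      σ₀ N + kv G v + k′ ∎)
    where
    open ≤-Reasoning
    M = (suc N) / 2
    M≤n : M ≤ n
    M≤n = m≤n⇒m≤1+n (m/n≤m (suc N) 2)
    k<k′ : k < k′
    k<k′ = ≤-trans k<s′ s′≤k′
    k′≤n : k′ ≤ n
    k′≤n = <⇒≤ (≤-trans k′<end (≤-reflexive end≡))
    marks : ℕ → ℕ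
    marks t = 𝟙 (t ≡ᵇ k) + 𝟙 (t ≡ᵇ k′)
    marks-0 : marks 0 ≡ 0
    marks-0 rewrite ≡ᵇ-false (<⇒≢ 1≤k) | ≡ᵇ-false (<⇒≢ (<-trans 1≤k k<k′)) = refl
    marks≤1 : ∀ t → marks t ≤ 1
    marks≤1 t with t ≡ᵇ k in t≡k
    ... | false = 𝟙≤1 _
    ... | true rewrite ≡ᵇ-false {t} {k′} (λ t≡k′ → <⇒≢ k<k′ (trans (sym (≡ᵇ-true⁻¹ t≡k)) t≡k′)) = s≤s z≤n
    marks-big : ∀ t → 1 ≤ marks t → 3 ≤ layer t
    marks-big t le with t ≡ᵇ k in t≡k
    ... | true = subst (λ t → 3 ≤ layer t) (sym (≡ᵇ-true⁻¹ t≡k)) (big k k-big)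
    ... | false = subst (λ t → 3 ≤ layer t) (sym (𝟙≡-pos le)) (big k′ k′-big)
    bound : ∀ i → beyond i ≡ 0 ⊎ beyond i + (1 + 2 * i + (𝟙 (k <ᵇ suc i) + 𝟙 (k′ <ᵇ suc i))) ≤ n
    bound i = Data.Sum.map₂ (subst (λ s → beyond i + (1 + 2 * i + s) ≤ n)
                                    (trans (∑<-distrib-+ (suc i) _ _) (cong₂ _+_ (∑<-𝟙-≡ (suc i) k) (∑<-𝟙-≡ (suc i) k′))))
                            (beyond-≤ marks marks-0 marks≤1 marks-big i)

  transmission-≤ : TransmissionBound
  transmission-≤ = by-big-levels (bigIdx G v) refl
    where
    by-big-levels : (ks : List ℕ) → bigIdx G v ≡ ks → TransmissionBound
    by-big-levels [] = transmission-≤-no-big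
    by-big-levels (_ ∷ []) = transmission-≤-one-big
    by-big-levels (_ ∷ _ ∷ _) = transmission-≤-two-big

ThinLevels : ∀ {n} → Graph n → Set
ThinLevels {n} Γ = ∀ v → let open Layers (dist Γ v) in
  Σ ℕ λ K → 1 ≤ K × 2 * K ≤ n × (∀ t → 1 ≤ t → ¬ t ≡ K → layer t ≤ 2) × layer K ≤ 3

module ThinVertex {N : ℕ} (Γ : Graph (suc (suc N))) (connected : Connected Γ) (v : Fin (suc (suc N)))
                  (K : ℕ) (1≤K : 1 ≤ K) (2K≤n : 2 * K ≤ suc (suc N)) where

  private
    n : ℕ
    n = suc (suc N)

  open Layers (dist Γ v)

  layer-0≤1 : layer 0 ≤ 1
  layer-0≤1 = count-≤1 _ (λ x y x0 y0 → trans (dist≡0⇒≡ Γ connected v x (≡ᵇ-true⁻¹ x0))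
                                              (sym (dist≡0⇒≡ Γ connected v y (≡ᵇ-true⁻¹ y0))))

  module _ (thin : ∀ t → 1 ≤ t → ¬ t ≡ K → layer t ≤ 2) (thin-K : layer K ≤ 3) where

    beyond-≥ : ∀ (e : ℕ → ℕ) → e 0 ≡ 0 → (∀ t → 1 ≤ t → layer t ≤ 2 + e t) → ∀ i →
               n ∸ (1 + 2 * i + ∑< (suc i) e) ≤ beyond i
    beyond-≥ e e0 layer≤ i = begin
        n ∸ (1 + 2 * i + ∑< (suc i) e)         ≤⟨ ∸-monoʳ-≤ n layers≤ ⟩
        n ∸ ∑< (suc i) layer                   ≡⟨ cong (_∸ ∑< (suc i) layer) (sym (beyond+layers i)) ⟩
        beyond i + ∑< (suc i) layer ∸ ∑< (suc i) layer ≡⟨ m+n∸n≡m (beyond i) (∑< (suc i) layer) ⟩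
        beyond i                               ∎
      where
      open ≤-Reasoning
      layer≤floor : ∀ t → t < suc i → layer t ≤ levelFloor e t
      layer≤floor zero _ = layer-0≤1
      layer≤floor (suc t) _ = layer≤ (suc t) (s≤s z≤n)
      layers≤ : ∑< (suc i) layer ≤ 1 + 2 * i + ∑< (suc i) e
      layers≤ = ≤-trans (∑<-mono-≤ (suc i) layer≤floor) (≤-reflexive (∑<-levelFloor e e0 i))

    private
      σ≡∑<-beyond : ∑ (dist Γ v) ≡ ∑< n beyond
      σ≡∑<-beyond = ∑≡∑<-beyond n (dist-≤-order Γ v)

      ω≡layer : ∀ t → ω Γ v t ≡ layer t
      ω≡layer t = countV≡count (λ x → dist Γ v x ≡ᵇ t)

      K<n : K < 1 + (n ∸ 1)
      K<n = ≤-trans (+-monoˡ-≤ K 1≤K) (≤-trans (≤-reflexive (cong (K +_) (sym (+-identityʳ K)))) 2K≤n)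

    open FilterUpFrom (λ i → 2 <ᵇ ω Γ v i)

    transmission-≥ : σ₀ N + kv Γ v ≤ ∑ (dist Γ v)
    transmission-≥ with 2 <ᵇ layer K in K-big
    ... | true = begin
        σ₀ N + kv Γ v                                      ≤⟨ +-monoʳ-≤ (σ₀ N) (kv≤K (bigIdx Γ v) refl) ⟩
        σ₀ N + K                                           ≡⟨ sym (∑<-σ₀-+ N K (<⇒≤ K<n)) ⟩
        ∑< n (λ i → N ∸ 2 * i + 𝟙 (i <ᵇ K))                ≤⟨ ∑<-mono-≤ n (λ i _ → beyond-lower₁ i K N 2K≤n) ⟩
        ∑< n (λ i → n ∸ (1 + 2 * i + 𝟙 (K <ᵇ suc i)))      ≡⟨ ∑<-cong n (λ i _ → cong (λ s → n ∸ (1 + 2 * i + s)) (sym (∑<-𝟙-≡ (suc i) K))) ⟩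
        ∑< n (λ i → n ∸ (1 + 2 * i + ∑< (suc i) (λ t → 𝟙 (t ≡ᵇ K)))) ≤⟨ ∑<-mono-≤ n (λ i _ → beyond-≥ (λ t → 𝟙 (t ≡ᵇ K)) K-unmarked layer≤ i) ⟩
        ∑< n beyond                                        ≡⟨ sym σ≡∑<-beyond ⟩
        ∑ (dist Γ v)                                       ∎
      where
      open ≤-Reasoning
      K-unmarked : 𝟙 (0 ≡ᵇ K) ≡ 0
      K-unmarked = cong 𝟙 (≡ᵇ-false (<⇒≢ 1≤K))
      layer≤ : ∀ t → 1 ≤ t → layer t ≤ 2 + 𝟙 (t ≡ᵇ K)
      layer≤ t 1≤t with t ≡ᵇ K in t≡K
      ... | true = subst (λ t → layer t ≤ 3) (sym (≡ᵇ-true⁻¹ t≡K)) thin-K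
      ... | false = ≤-trans (thin t 1≤t (≡ᵇ-false⁻¹ t≡K))
                            (≤-reflexive (sym (+-identityʳ 2)))
      kv≤K : (ks : List ℕ) → bigIdx Γ v ≡ ks → kv Γ v ≤ K
      kv≤K [] eq with () ← trans (sym (filter-upFrom-[] (n ∸ 1) 1 eq K 1≤K K<n)) (trans (cong (2 <ᵇ_) (ω≡layer K)) K-big)
      kv≤K (k ∷ ks) eq = ≤-trans (≤-reflexive (kv-∷ Γ v eq))
                                 (filter-upFrom-least (n ∸ 1) 1 k ks eq K 1≤K K<n (trans (cong (2 <ᵇ_) (ω≡layer K)) K-big))
    ... | false = begin
        σ₀ N + kv Γ v                              ≡⟨ cong (σ₀ N +_) (kv-[] Γ v no-big) ⟩
        σ₀ N + n / 2                               ≡⟨ sym (∑<-σ₀-+ N (n / 2) (m/n≤m n 2)) ⟩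
        ∑< n (λ i → N ∸ 2 * i + 𝟙 (i <ᵇ n / 2))    ≤⟨ ∑<-mono-≤ n (λ i _ → beyond-lower₀ i N) ⟩
        ∑< n (λ i → n ∸ (1 + 2 * i + 0))           ≡⟨ ∑<-cong n (λ i _ → cong (λ s → n ∸ (1 + 2 * i + s)) (sym (∑<-zero (suc i)))) ⟩
        ∑< n (λ i → n ∸ (1 + 2 * i + ∑< (suc i) (λ _ → 0))) ≤⟨ ∑<-mono-≤ n (λ i _ → beyond-≥ (λ _ → 0) refl layer≤ i) ⟩
        ∑< n beyond                                ≡⟨ sym σ≡∑<-beyond ⟩
        ∑ (dist Γ v)                               ∎
      where
      open ≤-Reasoning
      ≤2 : ∀ {a} → (2 <ᵇ a) ≡ false → a ≤ 2
      ≤2 {zero} _ = z≤n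
      ≤2 {suc zero} _ = s≤s z≤n
      ≤2 {suc (suc zero)} _ = s≤s (s≤s z≤n)
      all≤2 : ∀ t → 1 ≤ t → layer t ≤ 2
      all≤2 t 1≤t with t ≟ K
      ... | no t≢K = thin t 1≤t t≢K
      ... | yes refl = ≤2 K-big
      layer≤ : ∀ t → 1 ≤ t → layer t ≤ 2 + 0
      layer≤ t 1≤t = ≤-trans (all≤2 t 1≤t) (≤-reflexive (sym (+-identityʳ 2)))
      no-big : bigIdx Γ v ≡ []
      no-big = filter-upFrom-[]-intro (n ∸ 1) 1 (λ i 1≤i _ → trans (cong (2 <ᵇ_) (ω≡layer i)) (≤2⇒false (all≤2 i 1≤i)))
        where
        ≤2⇒false : ∀ {a} → a ≤ 2 → (2 <ᵇ a) ≡ false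
        ≤2⇒false z≤n = refl
        ≤2⇒false (s≤s z≤n) = refl
        ≤2⇒false (s≤s (s≤s z≤n)) = refl

-- Comparison of Wiener indices

sum-filterᵇ : ∀ {A : Set} (p : A → Bool) (f : A → ℕ) xs →
              sum (map f (filterᵇ p xs)) ≡ sum (map (λ x → if p x then f x else 0) xs)
sum-filterᵇ p f [] = refl
sum-filterᵇ p f (x ∷ xs) with p x
... | true = cong (f x +_) (sum-filterᵇ p f xs)
... | false = sum-filterᵇ p f xs

sum-concatMap : ∀ {A : Set} (f : A → List ℕ) xs → sum (concatMap f xs) ≡ sum (map (sum ∘′ f) xs)
sum-concatMap f [] = refl
sum-concatMap f (x ∷ xs) = trans (sum-++ (f x) _) (cong (sum (f x) +_) (sum-concatMap f xs))

2*W≡∑-transmissions : ∀ {n} (G : Graph n) → Connected G → 2 * W G ≡ ∑ (λ u → ∑ (dist G u))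
2*W≡∑-transmissions {n} G connected = begin
    2 * W G
  ≡⟨ cong (2 *_) W≡upper ⟩
    upper + (upper + 0)
  ≡⟨ cong (upper +_) (trans (+-identityʳ upper) upper≡lower) ⟩
    upper + lower
  ≡⟨ ∑-distrib-+ (λ u → ∑ (λ v → if toℕ u <ᵇ toℕ v then dist G u v else 0)) (λ u → ∑ (λ v → if toℕ v <ᵇ toℕ u then dist G u v else 0)) ⟨
    ∑ (λ u → ∑ (λ v → if toℕ u <ᵇ toℕ v then dist G u v else 0) + ∑ (λ v → if toℕ v <ᵇ toℕ u then dist G u v else 0))
  ≡⟨ sum-cong-≗ (λ u → trans (sym (∑-distrib-+ (λ v → if toℕ u <ᵇ toℕ v then dist G u v else 0) (λ v → if toℕ v <ᵇ toℕ u then dist G u v else 0)))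
                              (sum-cong-≗ (λ v → halves (toℕ u) (toℕ v) (dist G u v) (λ e → trans (cong (dist G u) (sym (toℕ-injective e))) (dist-refl G u))))) ⟩
    ∑ (λ u → ∑ (dist G u)) ∎
  where
  open ≡-Reasoning
  upper lower : ℕ
  upper = ∑ (λ u → ∑ (λ v → if toℕ u <ᵇ toℕ v then dist G u v else 0))
  lower = ∑ (λ u → ∑ (λ v → if toℕ v <ᵇ toℕ u then dist G u v else 0))
  W≡upper : W G ≡ upper
  W≡upper = begin
      W G
    ≡⟨ sum-concatMap (λ u → map (dist G u) (filterᵇ (λ v → toℕ u <ᵇ toℕ v) (allFin n))) (allFin n) ⟩
      sum (map (λ u → sum (map (dist G u) (filterᵇ (λ v → toℕ u <ᵇ toℕ v) (allFin n)))) (allFin n))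
    ≡⟨ sum-map-allFin (λ u → sum (map (dist G u) (filterᵇ (λ v → toℕ u <ᵇ toℕ v) (allFin n)))) ⟩
      ∑ (λ u → sum (map (dist G u) (filterᵇ (λ v → toℕ u <ᵇ toℕ v) (allFin n))))
    ≡⟨ sum-cong-≗ (λ u → trans (sum-filterᵇ (λ v → toℕ u <ᵇ toℕ v) (dist G u) (allFin n))
                               (sum-map-allFin (λ v → if toℕ u <ᵇ toℕ v then dist G u v else 0))) ⟩
      upper ∎
  upper≡lower : upper ≡ lower
  upper≡lower = trans (∑-comm (λ u v → if toℕ u <ᵇ toℕ v then dist G u v else 0))
                      (sum-cong-≗ (λ u → sum-cong-≗ (λ v → cong (if toℕ v <ᵇ toℕ u then_else 0) (dist-sym G connected v u))))
  halves : ∀ a b D → (a ≡ b → D ≡ 0) → (if a <ᵇ b then D else 0) + (if b <ᵇ a then D else 0) ≡ D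
  halves a b D diag with <-cmp a b
  ... | tri< a<b _ _ rewrite <ᵇ-true a<b | <ᵇ-false {b} {a} (<⇒≤ a<b) = +-identityʳ D
  ... | tri≈ _ refl _ rewrite <ᵇ-false {a} {a} ≤-refl = sym (diag refl)
  ... | tri> _ _ b<a rewrite <ᵇ-true b<a | <ᵇ-false {a} {b} (<⇒≤ b<a) = refl

sumℤ-map-- : ∀ {n} (f : Fin n → ℤ) (g h : Fin n → ℕ) → (∀ x → f x ≡ ⁺ g x -ℤ ⁺ h x) →
             sumℤ (map f (allFin n)) ≡ ⁺ ∑ g -ℤ ⁺ ∑ h
sumℤ-map-- {n} f g h f≡g-h = trans (go (allFin n)) (cong₂ (λ a c → ⁺ a -ℤ ⁺ c) (sum-map-allFin g) (sum-map-allFin h))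
  where
  regroup : ∀ (a b c d : ℤ) → (a -ℤ b) +ℤ (c -ℤ d) ≡ (a +ℤ c) -ℤ (b +ℤ d)
  regroup = ℤ-Solver.solve-∀
  go : ∀ xs → sumℤ (map f xs) ≡ ⁺ sum (map g xs) -ℤ ⁺ sum (map h xs)
  go [] = refl
  go (x ∷ xs) rewrite f≡g-h x | go xs | ℤ.pos-+ (g x) (sum (map g xs)) | ℤ.pos-+ (h x) (sum (map h xs)) =
    regroup (⁺ g x) (⁺ h x) (⁺ sum (map g xs)) (⁺ sum (map h xs))

+<+-+⇒<ℕ : ∀ x a b c → ⁺ x <ℤ (⁺ a -ℤ ⁺ b) +ℤ ⁺ c → x + b < a + c
+<+-+⇒<ℕ x a b c lt = ℤ.drop‿+<+ (subst₂ _<ℤ_ (trans (sym (ℤ.pos-+ b x)) (cong ⁺_ (+-comm b x)))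
                                            (trans (cancel (⁺ a) (⁺ b) (⁺ c)) (sym (ℤ.pos-+ a c)))
                                            (ℤ.+-monoʳ-< (⁺ b) lt))
  where
  cancel : ∀ (a b c : ℤ) → b +ℤ ((a -ℤ b) +ℤ c) ≡ a +ℤ c
  cancel = ℤ-Solver.solve-∀

module _ {N : ℕ} where

  private
    n : ℕ
    n = suc (suc N)

    nσ₀ : ℕ
    nσ₀ = ∑ {n} (λ _ → σ₀ N)

  total-transmission-≤ : (G : Graph n) → TwoConnected G →
    Σ ℕ λ B₁ → Σ ℕ λ B₂ → b G ≡ ⁺ B₁ -ℤ ⁺ B₂ × ∑ (λ u → ∑ (dist G u)) + B₁ ≤ nσ₀ + sumK G + B₂
  total-transmission-≤ G two-connected = ∑ B₁ , ∑ B₂ , sumℤ-map-- (bContrib G) B₁ B₂ (proj₁ ∘ proj₂ ∘ proj₂ ∘ bound) , (begin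
      ∑ (λ u → ∑ (dist G u)) + ∑ B₁        ≡⟨ ∑-distrib-+ (λ u → ∑ (dist G u)) B₁ ⟨
      ∑ (λ u → ∑ (dist G u) + B₁ u)        ≤⟨ ∑-mono-≤ (proj₂ ∘ proj₂ ∘ proj₂ ∘ bound) ⟩
      ∑ (λ u → σ₀ N + kv G u + B₂ u)       ≡⟨ ∑-distrib-+ (λ u → σ₀ N + kv G u) B₂ ⟩
      ∑ (λ u → σ₀ N + kv G u) + ∑ B₂       ≡⟨ cong (_+ ∑ B₂) (trans (∑-distrib-+ {n} (λ _ → σ₀ N) (kv G)) (cong (nσ₀ +_) (sym (sum-map-allFin (kv G))))) ⟩
      nσ₀ + sumK G + ∑ B₂                  ∎)
    where
    open ≤-Reasoning
    bound : ∀ v → TwoConnectedVertex.TransmissionBound G two-connected v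
    bound = TwoConnectedVertex.transmission-≤ G two-connected
    B₁ B₂ : Fin n → ℕ
    B₁ v = proj₁ (bound v)
    B₂ v = proj₁ (proj₂ (bound v))

  total-transmission-≥ : (Γ : Graph n) → Connected Γ → ThinLevels Γ →
    nσ₀ + sumK Γ ≤ ∑ (λ u → ∑ (dist Γ u))
  total-transmission-≥ Γ connected thin = begin
      nσ₀ + sumK Γ                 ≡⟨ cong (nσ₀ +_) (sum-map-allFin (kv Γ)) ⟩
      nσ₀ + ∑ (kv Γ)               ≡⟨ ∑-distrib-+ {n} (λ _ → σ₀ N) (kv Γ) ⟨
      ∑ (λ u → σ₀ N + kv Γ u)      ≤⟨ ∑-mono-≤ bound ⟩
      ∑ (λ u → ∑ (dist Γ u))       ∎
    where
    open ≤-Reasoning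
    bound : ∀ v → σ₀ N + kv Γ v ≤ ∑ (dist Γ v)
    bound v with K , 1≤K , 2K≤n , thin-levels , thin-K ← thin v = ThinVertex.transmission-≥ Γ connected v K 1≤K 2K≤n thin-levels thin-K

  W<W-thin : (G Γ : Graph n) → TwoConnected G → Connected Γ → ThinLevels Γ →
             ⁺ sumK G <ℤ b G +ℤ ⁺ sumK Γ → W G < W Γ
  W<W-thin G Γ two-connected connected thin hyp =
    let B₁ , B₂ , b≡ , G-bound = total-transmission-≤ G two-connected in
    *-cancelˡ-< 2 (W G) (W Γ) (+-cancelʳ-< B₁ (2 * W G) (2 * W Γ) (begin-strict
      2 * W G + B₁                     ≡⟨ cong (_+ B₁) (2*W≡∑-transmissions G (proj₁ (proj₂ two-connected))) ⟩
      ∑ (λ u → ∑ (dist G u)) + B₁      ≤⟨ G-bound ⟩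
      nσ₀ + sumK G + B₂                ≡⟨ +-assoc nσ₀ (sumK G) B₂ ⟩
      nσ₀ + (sumK G + B₂)              <⟨ +-monoʳ-< nσ₀ (+<+-+⇒<ℕ (sumK G) B₁ B₂ (sumK Γ) (subst (λ β → ⁺ sumK G <ℤ β +ℤ ⁺ sumK Γ) b≡ hyp)) ⟩
      nσ₀ + (B₁ + sumK Γ)              ≡⟨ cong (nσ₀ +_) (+-comm B₁ (sumK Γ)) ⟩
      nσ₀ + (sumK Γ + B₁)              ≡⟨ +-assoc nσ₀ (sumK Γ) B₁ ⟨
      nσ₀ + sumK Γ + B₁                ≤⟨ +-monoˡ-≤ B₁ (total-transmission-≥ Γ connected thin) ⟩
      ∑ (λ u → ∑ (dist Γ u)) + B₁      ≡⟨ cong (_+ B₁) (2*W≡∑-transmissions Γ connected) ⟨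
      2 * W Γ + B₁                     ∎))
    where
    open ≤-Reasoning

-- The graphs H_{n,1,2} and H_{n,2,2}

-- The cycle of length m on the positions 0, …, m - 1; fwd p q counts the forward steps from p to q.
module Cycle (m : ℕ) where
  next : ℕ → ℕ
  next q = if suc q ≡ᵇ m then 0 else suc q

  fwd : ℕ → ℕ → ℕ
  fwd p q = if p ≤ᵇ q then q ∸ p else (q + m) ∸ p

  fwd-cases : ∀ p q → p < m → (p ≤ q × fwd p q + p ≡ q) ⊎ (q < p × fwd p q + p ≡ q + m)
  fwd-cases p q p<m with p ≤? q
  ... | yes le rewrite ≤ᵇ-true le = inj₁ (le , m∸n+n≡m le)
  ... | no nle rewrite ≤ᵇ-false (≰⇒> nle) = inj₂ (≰⇒> nle , m∸n+n≡m {q + m} {p} (≤-trans (<⇒≤ p<m) (m≤n+m m q)))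

  next-cases : ∀ q → (suc q ≡ m × next q ≡ 0) ⊎ (¬ (suc q ≡ m) × next q ≡ suc q)
  next-cases q with suc q ≟ m
  ... | yes e rewrite e | ≡ᵇ-refl m = inj₁ (refl , refl)
  ... | no ne rewrite ≡ᵇ-false ne = inj₂ (ne , refl)

  next-last : ∀ {q} → suc q ≡ m → next q ≡ 0
  next-last {q} e with next-cases q
  ... | inj₁ (_ , e′) = e′
  ... | inj₂ (ne , _) = ⊥-elim (ne e)

  next-mid : ∀ {q} → suc q < m → next q ≡ suc q
  next-mid {q} lt with next-cases q
  ... | inj₁ (e , _) = ⊥-elim (<-irrefl e lt)
  ... | inj₂ (_ , e) = e

  next< : ∀ q → q < m → next q < m
  next< q lt with next-cases q
  ... | inj₁ (e , s0) rewrite s0 = ≤-trans (s≤s z≤n) lt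
  ... | inj₂ (ne , s1) rewrite s1 = ≤∧≢⇒< lt ne

  fwd< : ∀ p q → p < m → q < m → fwd p q < m
  fwd< p q p<m q<m with fwd-cases p q p<m
  ... | inj₁ (le , e) = ≤-<-trans (≤-trans (m≤m+n _ p) (≤-reflexive e)) q<m
  ... | inj₂ (lt , e) = +-cancelʳ-< p (fwd p q) m (≤-trans (s≤s (≤-reflexive e)) (≤-trans (+-monoˡ-≤ m lt) (≤-reflexive (+-comm p m))))

  fwd-refl : ∀ p → fwd p p ≡ 0
  fwd-refl p rewrite ≤ᵇ-true (≤-refl {p}) = n∸n≡0 p

  fwd≡0⇒≡ : ∀ p q → p < m → fwd p q ≡ 0 → p ≡ q
  fwd≡0⇒≡ p q p<m e with fwd-cases p q p<m
  ... | inj₁ (le , e2) rewrite e = e2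
  ... | inj₂ (lt , e2) rewrite e = ⊥-elim (<⇒≱ p<m (≤-trans (m≤n+m m q) (≤-reflexive (sym e2))))

  fwd-unwrapped : ∀ p q a → p < m → a + p ≡ q → fwd p q ≡ a
  fwd-unwrapped p q a p<m e with fwd-cases p q p<m
  ... | inj₁ (_ , e2) = +-cancelʳ-≡ p _ _ (trans e2 (sym e))
  ... | inj₂ (lt , _) = ⊥-elim (<⇒≱ lt (≤-trans (m≤n+m p a) (≤-reflexive e)))

  fwd-wrapped : ∀ p q a → p < m → q < p → a + p ≡ q + m → fwd p q ≡ a
  fwd-wrapped p q a p<m lt e with fwd-cases p q p<m
  ... | inj₁ (le , _) = ⊥-elim (<⇒≱ lt le)
  ... | inj₂ (_ , e2) = +-cancelʳ-≡ p _ _ (trans e2 (sym e))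

  fwd-next : ∀ p r → p < m → r < m → ¬ (next r ≡ p) → fwd p (next r) ≡ suc (fwd p r)
  fwd-next p r p<m r<m ne with next-cases r
  ... | inj₁ (e , s0) with fwd-cases p r p<m
  ...   | inj₁ (le , e2) = trans (cong (fwd p) s0) (fwd-wrapped p 0 (suc (fwd p r)) p<m (n≢0⇒n>0 (λ z → ne (trans s0 (sym z)))) (trans (cong suc e2) e))
  ...   | inj₂ (lt , _) = ⊥-elim (<⇒≱ p<m (≤-trans (≤-reflexive (sym e)) lt))
  fwd-next p r p<m r<m ne | inj₂ (ne2 , s1) with fwd-cases p r p<m
  ... | inj₁ (le , e2) = trans (cong (fwd p) s1) (fwd-unwrapped p (suc r) (suc (fwd p r)) p<m (cong suc e2))
  ... | inj₂ (lt , e2) = trans (cong (fwd p) s1) (fwd-wrapped p (suc r) (suc (fwd p r)) p<m (≤∧≢⇒< lt (λ z → ne (trans s1 z))) (cong suc e2))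

  fwd-from-next : ∀ q p → p < m → q < m → ¬ (q ≡ p) → fwd q p ≡ suc (fwd (next q) p)
  fwd-from-next q p p<m q<m ne with next-cases q
  ... | inj₁ (e , s0) = trans (fwd-wrapped q p (suc p) q<m (≤∧≢⇒< (≤-pred (≤-trans p<m (≤-reflexive (sym e)))) (λ z → ne (sym z)))
          (trans (sym (+-suc p q)) (cong (p +_) e))) (cong (λ w → suc (fwd w p)) (sym s0))
  ... | inj₂ (ne2 , s1) with fwd-cases (suc q) p (≤∧≢⇒< q<m ne2)
  ...   | inj₁ (le , e2) = trans (fwd-unwrapped q p (suc (fwd (suc q) p)) q<m (trans (sym (+-suc _ q)) e2)) (cong (λ w → suc (fwd w p)) (sym s1))
  ...   | inj₂ (lt , e2) = trans (fwd-wrapped q p (suc (fwd (suc q) p)) q<m (≤∧≢⇒< (≤-pred lt) (λ z → ne (sym z))) (trans (sym (+-suc _ q)) e2)) (cong (λ w → suc (fwd w p)) (sym s1))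

  fwd-injectiveʳ : ∀ p q q' → p < m → q < m → q' < m → fwd p q ≡ fwd p q' → q ≡ q'
  fwd-injectiveʳ p q q' p<m q<m qm' e with fwd-cases p q p<m | fwd-cases p q' p<m
  ... | inj₁ (_ , e1) | inj₁ (_ , e2) = trans (sym e1) (trans (cong (_+ p) e) e2)
  ... | inj₂ (_ , e1) | inj₂ (_ , e2) = +-cancelʳ-≡ m _ _ (trans (sym e1) (trans (cong (_+ p) e) e2))
  ... | inj₁ (_ , e1) | inj₂ (_ , e2) = ⊥-elim (<⇒≱ q<m (≤-trans (m≤n+m m q') (≤-reflexive (trans (sym e2) (trans (cong (_+ p) (sym e)) e1)))))
  ... | inj₂ (_ , e1) | inj₁ (_ , e2) = ⊥-elim (<⇒≱ qm' (≤-trans (m≤n+m m q) (≤-reflexive (trans (sym e1) (trans (cong (_+ p) e) e2)))))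

  fwd-injectiveˡ : ∀ q q' p → p < m → q < m → q' < m → fwd q p ≡ fwd q' p → q ≡ q'
  fwd-injectiveˡ q q' p p<m q<m qm' e with fwd-cases q p q<m | fwd-cases q' p qm'
  ... | inj₁ (_ , e1) | inj₁ (_ , e2) = +-cancelˡ-≡ (fwd q p) _ _ (trans e1 (trans (sym e2) (cong (_+ q') (sym e))))
  ... | inj₂ (_ , e1) | inj₂ (_ , e2) = +-cancelˡ-≡ (fwd q p) _ _ (trans e1 (trans (sym e2) (cong (_+ q') (sym e))))
  ... | inj₁ (_ , e1) | inj₂ (_ , e2) = ⊥-elim (<⇒≱ qm' (+-cancelˡ-≤ p m q' (≤-trans (≤-reflexive (trans (sym e2) (cong (_+ q') (sym e)))) (+-monoˡ-≤ q' (≤-trans (m≤m+n (fwd q p) q) (≤-reflexive e1))))))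
  ... | inj₂ (_ , e1) | inj₁ (_ , e2) = ⊥-elim (<⇒≱ q<m (+-cancelˡ-≤ p m q (≤-trans (≤-reflexive (trans (sym e1) (cong (_+ q) e))) (+-monoˡ-≤ q (≤-trans (m≤m+n (fwd q' p) q') (≤-reflexive e2))))))

  cdist : ℕ → ℕ → ℕ
  cdist p q = fwd p q ⊓ fwd q p

  cdist-sym : ∀ p q → cdist p q ≡ cdist q p
  cdist-sym p q = ⊓-comm (fwd p q) (fwd q p)

  cdist-refl : ∀ p → cdist p p ≡ 0
  cdist-refl p rewrite fwd-refl p = refl

  cdist≤fwd : ∀ p q → cdist p q ≤ fwd p q
  cdist≤fwd p q = m⊓n≤m (fwd p q) (fwd q p)
  cdist≤bwd : ∀ p q → cdist p q ≤ fwd q p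
  cdist≤bwd p q = m⊓n≤n (fwd p q) (fwd q p)

  cdist-sel : ∀ p q → cdist p q ≡ fwd p q ⊎ cdist p q ≡ fwd q p
  cdist-sel p q = ⊓-sel (fwd p q) (fwd q p)

  cdist< : ∀ p q → p < m → q < m → cdist p q < m
  cdist< p q p<m q<m = ≤-<-trans (cdist≤fwd p q) (fwd< p q p<m q<m)

  cdist≡0⇒≡ : ∀ p q → p < m → q < m → cdist p q ≡ 0 → p ≡ q
  cdist≡0⇒≡ p q p<m q<m e with cdist-sel p q
  ... | inj₁ x = fwd≡0⇒≡ p q p<m (trans (sym x) e)
  ... | inj₂ x = sym (fwd≡0⇒≡ q p q<m (trans (sym x) e))

  private
    fwd-next-≤ : ∀ p q → p < m → q < m → fwd p (next q) ≤ suc (fwd p q)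
    fwd-next-≤ p q p<m q<m with next q ≟ p
    ... | yes e rewrite e | fwd-refl p = z≤n
    ... | no ne rewrite fwd-next p q p<m q<m ne = ≤-refl

    fwd-from-next-≤ : ∀ p q → p < m → q < m → ¬ (q ≡ p) → fwd (next q) p ≤ fwd q p
    fwd-from-next-≤ p q p<m q<m ne rewrite fwd-from-next q p p<m q<m ne = n≤1+n _

    fwd-≤-next : ∀ p q → p < m → q < m → ¬ (next q ≡ p) → fwd p q ≤ fwd p (next q)
    fwd-≤-next p q p<m q<m ne rewrite fwd-next p q p<m q<m ne = n≤1+n _

    fwd-≤-from-next : ∀ p q → p < m → q < m → fwd q p ≤ suc (fwd (next q) p)
    fwd-≤-from-next p q p<m q<m with q ≟ p
    ... | yes e rewrite e | fwd-refl p = z≤n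
    ... | no ne rewrite fwd-from-next q p p<m q<m ne = ≤-refl

  cdist-next-≤ : ∀ p q → p < m → q < m → cdist p (next q) ≤ suc (cdist p q)
  cdist-next-≤ p q p<m q<m with cdist-sel p q
  ... | inj₁ x = ≤-trans (cdist≤fwd p (next q)) (≤-trans (fwd-next-≤ p q p<m q<m) (s≤s (≤-reflexive (sym x))))
  ... | inj₂ x with q ≟ p
  ...   | yes refl = ≤-trans (cdist≤fwd p (next p)) (≤-trans (fwd-next-≤ p p p<m q<m) (s≤s (≤-reflexive (sym x))))
  ...   | no ne = ≤-trans (cdist≤bwd p (next q)) (≤-trans (fwd-from-next-≤ p q p<m q<m ne) (≤-trans (n≤1+n _) (s≤s (≤-reflexive (sym x)))))

  cdist-≤-next : ∀ p q → p < m → q < m → cdist p q ≤ suc (cdist p (next q))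
  cdist-≤-next p q p<m q<m with cdist-sel p (next q)
  ... | inj₂ x = ≤-trans (cdist≤bwd p q) (≤-trans (fwd-≤-from-next p q p<m q<m) (s≤s (≤-reflexive (sym x))))
  ... | inj₁ x with next q ≟ p
  ...   | yes e = ≤-trans (cdist≤bwd p q) (≤-trans (fwd-≤-from-next p q p<m q<m) (s≤s (≤-reflexive (trans (cong (λ w → fwd w p) e) (trans (sym (cong (fwd p) e)) (sym x))))))
  ...   | no ne = ≤-trans (cdist≤fwd p q) (≤-trans (fwd-≤-next p q p<m q<m ne) (≤-trans (n≤1+n _) (s≤s (≤-reflexive (sym x)))))

  cdist-descent : ∀ p q r t → p < m → q < m → r < m → next r ≡ q → cdist p q ≡ suc t → cdist p r ≡ t ⊎ cdist p (next q) ≡ t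
  cdist-descent p q r t p<m q<m r<m sr e with q ≟ p
  ... | yes refl rewrite cdist-refl q with e
  ... | ()
  cdist-descent p q r t p<m q<m r<m sr e | no ne with cdist-sel p q
  ... | inj₁ x = inj₁ (≤-antisym l1 l2)
    where
    fr : fwd p r ≡ t
    fr = suc-injective (trans (sym (fwd-next p r p<m r<m (λ z → ne (trans (sym sr) z)))) (trans (cong (fwd p) sr) (trans (sym x) e)))
    l1 : cdist p r ≤ t
    l1 = ≤-trans (cdist≤fwd p r) (≤-reflexive fr)
    l2 : t ≤ cdist p r
    l2 = ≤-pred (≤-trans (≤-reflexive (trans (sym e) (cong (cdist p) (sym sr)))) (cdist-next-≤ p r p<m r<m))
  ... | inj₂ x = inj₂ (≤-antisym l1 l2)
    where
    fr : fwd (next q) p ≡ t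
    fr = suc-injective (trans (sym (fwd-from-next q p p<m q<m ne)) (trans (sym x) e))
    l1 : cdist p (next q) ≤ t
    l1 = ≤-trans (cdist≤bwd p (next q)) (≤-reflexive fr)
    l2 : t ≤ cdist p (next q)
    l2 = ≤-pred (≤-trans (≤-reflexive (sym e)) (cdist-≤-next p q p<m q<m))

⊓-sel-≤ : ∀ a b c → a ⊓ b ≡ c → (a ≡ c × c ≤ b) ⊎ (b ≡ c × c ≤ a)
⊓-sel-≤ a b c e with ⊓-sel a b
... | inj₁ a⊓b≡a = inj₁ (trans (sym a⊓b≡a) e , ≤-trans (≤-reflexive (sym e)) (m⊓n≤n a b))
... | inj₂ a⊓b≡b = inj₂ (trans (sym a⊓b≡b) e , ≤-trans (≤-reflexive (sym e)) (m⊓n≤m a b))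

⊓-suc-≤ : ∀ a b a′ b′ → a′ ≤ suc a → b′ ≤ suc b → a′ ⊓ b′ ≤ suc (a ⊓ b)
⊓-suc-≤ a b a′ b′ a′≤ b′≤ with ⊓-sel a b
... | inj₁ e rewrite e = ≤-trans (m⊓n≤m a′ b′) a′≤
... | inj₂ e rewrite e = ≤-trans (m⊓n≤n a′ b′) b′≤

≤2+⊓ : ∀ x a b → x ≤ 2 + a → x ≤ 2 + b → x ≤ 2 + a ⊓ b
≤2+⊓ x a b x≤a x≤b with ⊓-sel a b
... | inj₁ e rewrite e = x≤a
... | inj₂ e rewrite e = x≤b

2*⊓≤+ : ∀ a b → 2 * (a ⊓ b) ≤ a + b
2*⊓≤+ a b with ⊓-sel a b
... | inj₁ e rewrite e | +-identityʳ a = +-monoʳ-≤ a (≤-trans (≤-reflexive (sym e)) (m⊓n≤n a b))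
... | inj₂ e rewrite e | +-identityʳ b = +-monoˡ-≤ b (≤-trans (≤-reflexive (sym e)) (m⊓n≤m a b))

-- Γ is a cycle of length m (a vertex x ≠ z sits at position pos x) together with an apex z whose
-- neighbours are the cycle positions 0 and s, where s = m - 1 or s = m - 2.
module ApexOverCycle {n} (Γ : Graph n) (m s : ℕ) (z : Fin n) (pos : Fin n → ℕ)
  (n≡1+m : n ≡ suc m) (3≤m : 3 ≤ m) (pos<m : ∀ x → pos x < m)
  (pos-injective : ∀ x y → ¬ x ≡ z → ¬ y ≡ z → pos x ≡ pos y → x ≡ y)
  (apex-span : (suc s ≡ m) ⊎ (suc (suc s) ≡ m × 4 ≤ m))
  (adj-cases : ∀ x y → adj Γ x y ≡ true →
     (¬ x ≡ z × ¬ y ≡ z × (pos y ≡ Cycle.next m (pos x) ⊎ pos x ≡ Cycle.next m (pos y))) ⊎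
     (x ≡ z × ¬ y ≡ z × (pos y ≡ 0 ⊎ pos y ≡ s)) ⊎
     (y ≡ z × ¬ x ≡ z × (pos x ≡ 0 ⊎ pos x ≡ s)))
  (next-neighbour : ∀ x → ¬ x ≡ z → Σ (Fin n) λ y → ¬ y ≡ z × pos y ≡ Cycle.next m (pos x) × adj Γ y x ≡ true)
  (prev-neighbour : ∀ x → ¬ x ≡ z → Σ (Fin n) λ y → ¬ y ≡ z × Cycle.next m (pos y) ≡ pos x × adj Γ y x ≡ true)
  (apex-0 : Σ (Fin n) λ y → ¬ y ≡ z × pos y ≡ 0 × adj Γ y z ≡ true)
  (apex-s : Σ (Fin n) λ y → ¬ y ≡ z × pos y ≡ s × adj Γ y z ≡ true)
  where
  open Cycle m

  s<m : s < m
  s<m = [ ≤-reflexive , (λ (e , _) → ≤-trans (n≤1+n _) (≤-reflexive e)) ]′ apex-span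

  2≤s : 2 ≤ s
  2≤s = [ (λ e → ≤-pred (≤-trans 3≤m (≤-reflexive (sym e)))) , (λ (e , 4≤m) → ≤-pred (≤-pred (≤-trans 4≤m (≤-reflexive (sym e))))) ]′ apex-span

  0<m : 0 < m
  0<m = ≤-trans (s≤s z≤n) 3≤m

  s-steps-to-0 : next s ≡ 0 ⊎ next (next s) ≡ 0
  s-steps-to-0 = Data.Sum.map next-last (λ (e , _) → trans (cong next (next-mid (≤-reflexive e))) (next-last e)) apex-span

  cdist-0≤2+cdist-s : ∀ p → p < m → cdist p 0 ≤ 2 + cdist p s
  cdist-0≤2+cdist-s p p<m with s-steps-to-0
  ... | inj₁ e = ≤-trans (≤-reflexive (cong (cdist p) (sym e))) (≤-trans (cdist-next-≤ p s p<m s<m) (n≤1+n _))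
  ... | inj₂ e = ≤-trans (≤-reflexive (cong (cdist p) (sym e)))
                         (≤-trans (cdist-next-≤ p (next s) p<m (next< s s<m)) (s≤s (cdist-next-≤ p s p<m s<m)))

  cdist-s≤2+cdist-0 : ∀ p → p < m → cdist p s ≤ 2 + cdist p 0
  cdist-s≤2+cdist-0 p p<m with s-steps-to-0
  ... | inj₁ e = ≤-trans (cdist-≤-next p s p<m s<m) (≤-trans (s≤s (≤-reflexive (cong (cdist p) e))) (n≤1+n _))
  ... | inj₂ e = ≤-trans (cdist-≤-next p s p<m s<m)
                         (s≤s (≤-trans (cdist-≤-next p (next s) p<m (next< s s<m)) (s≤s (≤-reflexive (cong (cdist p) e)))))

  apexDist : ℕ → ℕ
  apexDist q = suc (cdist 0 q ⊓ cdist s q)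

  -- The distances of Γ in closed form.
  hDist : Fin n → Fin n → ℕ
  hDist v x with v ≟F z | x ≟F z
  ... | yes _ | yes _ = 0
  ... | yes _ | no _ = apexDist (pos x)
  ... | no _ | yes _ = apexDist (pos v)
  ... | no _ | no _ = cdist (pos v) (pos x)

  hDist-apex-apex : hDist z z ≡ 0
  hDist-apex-apex with z ≟F z
  ... | yes _ = refl
  ... | no ne = ⊥-elim (ne refl)

  hDist-apex : ∀ x → ¬ x ≡ z → hDist z x ≡ apexDist (pos x)
  hDist-apex x nx with z ≟F z | x ≟F z
  ... | yes _ | no _ = refl
  ... | yes _ | yes e = ⊥-elim (nx e)
  ... | no ne | _ = ⊥-elim (ne refl)

  hDist-to-apex : ∀ v → ¬ v ≡ z → hDist v z ≡ apexDist (pos v)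
  hDist-to-apex v nv with v ≟F z | z ≟F z
  ... | no _ | yes _ = refl
  ... | yes e | _ = ⊥-elim (nv e)
  ... | _ | no ne = ⊥-elim (ne refl)

  hDist-cycle : ∀ v x → ¬ v ≡ z → ¬ x ≡ z → hDist v x ≡ cdist (pos v) (pos x)
  hDist-cycle v x nv nx with v ≟F z | x ≟F z
  ... | no _ | no _ = refl
  ... | yes e | _ = ⊥-elim (nv e)
  ... | no _ | yes e = ⊥-elim (nx e)

  apex? : ∀ v → v ≡ z ⊎ ¬ v ≡ z
  apex? v with v ≟F z
  ... | yes e = inj₁ e
  ... | no ne = inj₂ ne

  apexDist-next-≤ : ∀ q → q < m → apexDist (next q) ≤ suc (apexDist q)
  apexDist-next-≤ q q<m = s≤s (⊓-suc-≤ _ _ _ _ (cdist-next-≤ 0 q 0<m q<m) (cdist-next-≤ s q s<m q<m))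

  apexDist-≤-next : ∀ q → q < m → apexDist q ≤ suc (apexDist (next q))
  apexDist-≤-next q q<m = s≤s (⊓-suc-≤ _ _ _ _ (cdist-≤-next 0 q 0<m q<m) (cdist-≤-next s q s<m q<m))

  apexDist-attached : ∀ q → q ≡ 0 ⊎ q ≡ s → apexDist q ≡ 1
  apexDist-attached q (inj₁ refl) = cong (λ c → suc (c ⊓ cdist s 0)) (cdist-refl 0)
  apexDist-attached q (inj₂ refl) = cong suc (trans (cong (cdist 0 s ⊓_) (cdist-refl s)) (⊓-zeroʳ _))

  hDist-refl : ∀ v → hDist v v ≡ 0
  hDist-refl v with apex? v
  ... | inj₁ refl = hDist-apex-apex
  ... | inj₂ nv = trans (hDist-cycle v v nv nv) (cdist-refl (pos v))

  hDist≡0⇒≡ : ∀ v x → hDist v x ≡ 0 → x ≡ v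
  hDist≡0⇒≡ v x e with apex? v | apex? x
  ... | inj₁ refl | inj₁ refl = refl
  ... | inj₁ refl | inj₂ nx with trans (sym (hDist-apex x nx)) e
  ... | ()
  hDist≡0⇒≡ v x e | inj₂ nv | inj₁ refl with trans (sym (hDist-to-apex v nv)) e
  ... | ()
  hDist≡0⇒≡ v x e | inj₂ nv | inj₂ nx = pos-injective x v nx nv (sym (cdist≡0⇒≡ (pos v) (pos x) (pos<m v) (pos<m x) (trans (sym (hDist-cycle v x nv nx)) e)))

  cdist-attached-≤ : ∀ p → p < m → ∀ q → (q ≡ 0 ⊎ q ≡ s) → cdist p q ≤ 2 + (cdist 0 p ⊓ cdist s p)
  cdist-attached-≤ p p<m q (inj₁ refl) = ≤2+⊓ _ _ _ (≤-trans (≤-reflexive (cdist-sym p 0)) (m≤n+m _ 2)) (≤-trans (cdist-0≤2+cdist-s p p<m) (≤-reflexive (cong (2 +_) (cdist-sym p s))))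
  cdist-attached-≤ p p<m q (inj₂ refl) = ≤2+⊓ _ _ _ (≤-trans (cdist-s≤2+cdist-0 p p<m) (≤-reflexive (cong (2 +_) (cdist-sym p 0)))) (≤-trans (≤-reflexive (cdist-sym p s)) (m≤n+m _ 2))

  hDist-adj : ∀ v x y → adj Γ x y ≡ true → hDist v y ≤ suc (hDist v x)
  hDist-adj v x y a with adj-cases x y a | apex? v
  ... | inj₁ (nx , ny , c) | inj₁ refl rewrite hDist-apex x nx | hDist-apex y ny with c
  ...   | inj₁ e rewrite e = apexDist-next-≤ (pos x) (pos<m x)
  ...   | inj₂ e rewrite e = apexDist-≤-next (pos y) (pos<m y)
  hDist-adj v x y a | inj₁ (nx , ny , c) | inj₂ nv rewrite hDist-cycle v x nv nx | hDist-cycle v y nv ny with c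
  ...   | inj₁ e rewrite e = cdist-next-≤ (pos v) (pos x) (pos<m v) (pos<m x)
  ...   | inj₂ e rewrite e = cdist-≤-next (pos v) (pos y) (pos<m v) (pos<m y)
  hDist-adj v x y a | inj₂ (inj₁ (refl , ny , c)) | inj₁ refl rewrite hDist-apex y ny | apexDist-attached (pos y) c | hDist-apex-apex = ≤-refl
  hDist-adj v x y a | inj₂ (inj₁ (refl , ny , c)) | inj₂ nv rewrite hDist-cycle v y nv ny | hDist-to-apex v nv = cdist-attached-≤ (pos v) (pos<m v) (pos y) c
  hDist-adj v x y a | inj₂ (inj₂ (refl , nx , c)) | inj₁ refl rewrite hDist-apex-apex = z≤n
  hDist-adj v x y a | inj₂ (inj₂ (refl , nx , c)) | inj₂ nv rewrite hDist-to-apex v nv | hDist-cycle v x nv nx with c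
  ... | inj₁ e rewrite e | cdist-sym (pos v) 0 = s≤s (m⊓n≤m _ _)
  ... | inj₂ e rewrite e | cdist-sym (pos v) s = s≤s (m⊓n≤n _ _)

  apexDist≤m : ∀ q → q < m → apexDist q ≤ m
  apexDist≤m q q<m = ≤-trans (s≤s (m⊓n≤m _ _)) (cdist< 0 q 0<m q<m)

  hDist≤m : ∀ v x → hDist v x ≤ m
  hDist≤m v x with apex? v | apex? x
  ... | inj₁ refl | inj₁ refl rewrite hDist-apex-apex = z≤n
  ... | inj₁ refl | inj₂ nx rewrite hDist-apex x nx = apexDist≤m (pos x) (pos<m x)
  ... | inj₂ nv | inj₁ refl rewrite hDist-to-apex v nv = apexDist≤m (pos v) (pos<m v)
  ... | inj₂ nv | inj₂ nx rewrite hDist-cycle v x nv nx = <⇒≤ (cdist< (pos v) (pos x) (pos<m v) (pos<m x))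

  adj-sym : ∀ x y → adj Γ x y ≡ true → adj Γ y x ≡ true
  adj-sym x y e = trans (Graph.sym Γ y x) e

  private
    cycle-descent : ∀ v x t → ¬ v ≡ z → ¬ x ≡ z → hDist v x ≡ suc t → Σ (Fin n) λ y → adj Γ y x ≡ true × hDist v y ≡ t
    cycle-descent v x t nv nx e
      with prev , n-prev , prev-pos , prev-x ← prev-neighbour x nx | nxt , n-nxt , nxt-pos , nxt-x ← next-neighbour x nx
      with cdist-descent (pos v) (pos x) (pos prev) t (pos<m v) (pos<m x) (pos<m prev) prev-pos (trans (sym (hDist-cycle v x nv nx)) e)
    ... | inj₁ h = prev , prev-x , trans (hDist-cycle v prev nv n-prev) h
    ... | inj₂ h = nxt , nxt-x , trans (hDist-cycle v nxt nv n-nxt) (trans (cong (cdist (pos v)) nxt-pos) h)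

    via-attachment : ∀ v c t → ¬ v ≡ z → (Σ (Fin n) λ y → ¬ y ≡ z × pos y ≡ c × adj Γ y z ≡ true) → cdist c (pos v) ≡ t →
                     Σ (Fin n) λ y → adj Γ y z ≡ true × hDist v y ≡ t
    via-attachment v c t nv (y , ny , pos-y , yz) e = y , yz , trans (hDist-cycle v y nv ny) (trans (cong (cdist (pos v)) pos-y) (trans (cdist-sym (pos v) c) e))

    descent-to-apex : ∀ v t → ¬ v ≡ z → hDist v z ≡ suc t → Σ (Fin n) λ y → adj Γ y z ≡ true × hDist v y ≡ t
    descent-to-apex v t nv e with ⊓-sel-≤ (cdist 0 (pos v)) (cdist s (pos v)) t (suc-injective (trans (sym (hDist-to-apex v nv)) e))
    ... | inj₁ (h , _) = via-attachment v 0 t nv apex-0 h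
    ... | inj₂ (h , _) = via-attachment v s t nv apex-s h

    attached-neighbour : ∀ c x → ¬ x ≡ z → c < m → (Σ (Fin n) λ y → ¬ y ≡ z × pos y ≡ c × adj Γ y z ≡ true) → cdist c (pos x) ≡ 0 →
                         Σ (Fin n) λ y → adj Γ y x ≡ true × hDist z y ≡ 0
    attached-neighbour c x nx c<m (y , ny , pos-y , yz) e with refl ← pos-injective y x ny nx (trans pos-y (cdist≡0⇒≡ c (pos x) c<m (pos<m x) e)) =
      z , adj-sym y z yz , hDist-apex-apex

    descent-from-apex : ∀ x t → ¬ x ≡ z → hDist z x ≡ suc t → Σ (Fin n) λ y → adj Γ y x ≡ true × hDist z y ≡ t
    descent-from-apex x zero nx e with ⊓-sel-≤ (cdist 0 (pos x)) (cdist s (pos x)) 0 (suc-injective (trans (sym (hDist-apex x nx)) e))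
    ... | inj₁ (h , _) = attached-neighbour 0 x nx 0<m apex-0 h
    ... | inj₂ (h , _) = attached-neighbour s x nx s<m apex-s h
    descent-from-apex x (suc t) nx e
      with prev , n-prev , prev-pos , prev-x ← prev-neighbour x nx | nxt , n-nxt , nxt-pos , nxt-x ← next-neighbour x nx
      = nearer-end (⊓-sel-≤ (cdist 0 (pos x)) (cdist s (pos x)) (suc t) (suc-injective (trans (sym (hDist-apex x nx)) e)))
      where
      at-level : ∀ y → adj Γ y x ≡ true → ¬ y ≡ z → (cdist 0 (pos y) ≡ t ⊎ cdist s (pos y) ≡ t) → hDist z y ≡ suc t
      at-level y yx ny c = ≤-antisym (≤-trans (≤-reflexive (hDist-apex y ny)) (s≤s (⊓≤ c)))
                                     (≤-pred (≤-trans (≤-reflexive (sym e)) (hDist-adj z y x yx)))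
        where
        ⊓≤ : (cdist 0 (pos y) ≡ t ⊎ cdist s (pos y) ≡ t) → cdist 0 (pos y) ⊓ cdist s (pos y) ≤ t
        ⊓≤ (inj₁ h) = ≤-trans (m⊓n≤m _ _) (≤-reflexive h)
        ⊓≤ (inj₂ h) = ≤-trans (m⊓n≤n _ _) (≤-reflexive h)
      nearer-end : (cdist 0 (pos x) ≡ suc t × suc t ≤ cdist s (pos x)) ⊎ (cdist s (pos x) ≡ suc t × suc t ≤ cdist 0 (pos x)) →
                   Σ (Fin n) λ y → adj Γ y x ≡ true × hDist z y ≡ suc t
      nearer-end (inj₁ (h , _)) with cdist-descent 0 (pos x) (pos prev) t 0<m (pos<m x) (pos<m prev) prev-pos h
      ... | inj₁ h′ = prev , prev-x , at-level prev prev-x n-prev (inj₁ h′)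
      ... | inj₂ h′ = nxt , nxt-x , at-level nxt nxt-x n-nxt (inj₁ (trans (cong (cdist 0) nxt-pos) h′))
      nearer-end (inj₂ (h , _)) with cdist-descent s (pos x) (pos prev) t s<m (pos<m x) (pos<m prev) prev-pos h
      ... | inj₁ h′ = prev , prev-x , at-level prev prev-x n-prev (inj₂ h′)
      ... | inj₂ h′ = nxt , nxt-x , at-level nxt nxt-x n-nxt (inj₂ (trans (cong (cdist s) nxt-pos) h′))

  hDist-descent : ∀ v x t → hDist v x ≡ suc t → Σ (Fin n) λ y → adj Γ y x ≡ true × hDist v y ≡ t
  hDist-descent v x t e with apex? v | apex? x
  ... | inj₁ refl | inj₁ refl with () ← trans (sym hDist-apex-apex) e
  ... | inj₁ refl | inj₂ nx = descent-from-apex x t nx e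
  ... | inj₂ nv | inj₁ refl = descent-to-apex v t nv e
  ... | inj₂ nv | inj₂ nx = cycle-descent v x t nv nx e

  hDist≤n : ∀ v x → hDist v x ≤ n
  hDist≤n v x = ≤-trans (hDist≤m v x) (≤-trans (n≤1+n m) (≤-reflexive (sym n≡1+m)))

  dist≡hDist : ∀ v x → dist Γ v x ≡ hDist v x
  dist≡hDist v = DistanceFromPotential.dist≡potential Γ v (hDist v) (hDist-refl v) (hDist≡0⇒≡ v) (hDist-adj v) (hDist-descent v) (hDist≤n v)

  connected : Connected Γ
  connected v = DistanceFromPotential.potential-connects Γ v (hDist v) (hDist-refl v) (hDist≡0⇒≡ v) (hDist-adj v) (hDist-descent v) (hDist≤n v)

  private
    level-via-0 : ∀ q u → q < m → cdist 0 q ≡ u → u ≤ cdist s q → q ≡ u ⊎ q ≡ s ∸ u ⊎ (q ≡ m ∸ 1 × u ≡ 1)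
    level-via-0 q u q<m h u≤cdist-s with cdist-sel 0 q
    ...   | inj₁ x = inj₁ (trans (sym x) h)
    ...   | inj₂ x = via-0 (q ≟ 0)
      where
      via-0 : Dec (q ≡ 0) → q ≡ u ⊎ q ≡ s ∸ u ⊎ (q ≡ m ∸ 1 × u ≡ 1)
      via-0 (yes refl) = inj₁ (trans (sym (fwd-refl 0)) (trans (sym x) h))
      via-0 (no nq) with fwd-cases q 0 q<m
      ... | inj₁ (le , _) = ⊥-elim (nq (n≤0⇒n≡0 le))
      ... | inj₂ (_ , e2) = by-side-of-s (q ≤? s)
        where
        u+q≡m : u + q ≡ m
        u+q≡m = trans (cong (_+ q) (trans (sym h) x)) e2
        by-side-of-s : Dec (q ≤ s) → q ≡ u ⊎ q ≡ s ∸ u ⊎ (q ≡ m ∸ 1 × u ≡ 1)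
        by-side-of-s (yes qs) with fwd-cases q s q<m
        ... | inj₂ (lt , _) = ⊥-elim (<⇒≱ lt qs)
        ... | inj₁ (_ , e3) = ⊥-elim (<⇒≱ s<m (≤-trans (≤-reflexive (sym u+q≡m)) (≤-trans (+-monoˡ-≤ q (≤-trans u≤cdist-s (cdist≤bwd s q))) (≤-reflexive e3))))
        by-side-of-s (no nqs) = by-span apex-span
          where
          by-span : ((suc s ≡ m) ⊎ (suc (suc s) ≡ m × 4 ≤ m)) → q ≡ u ⊎ q ≡ s ∸ u ⊎ (q ≡ m ∸ 1 × u ≡ 1)
          by-span (inj₁ e4) = ⊥-elim (nqs (≤-pred (≤-trans q<m (≤-reflexive (sym e4)))))
          by-span (inj₂ (e4 , _)) = inj₂ (inj₂ (qeq , u1))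
            where
            qeq' : q ≡ suc s
            qeq' = ≤-antisym (≤-pred (≤-trans q<m (≤-reflexive (sym e4)))) (≰⇒> nqs)
            qeq : q ≡ m ∸ 1
            qeq = trans qeq' (cong (_∸ 1) e4)
            u1 : u ≡ 1
            u1 = +-cancelʳ-≡ q u 1 (trans u+q≡m (trans (sym e4) (cong suc (sym qeq'))))

    level-via-s : ∀ q u → q < m → cdist s q ≡ u → u ≤ cdist 0 q → q ≡ u ⊎ q ≡ s ∸ u ⊎ (q ≡ m ∸ 1 × u ≡ 1)
    level-via-s q u q<m h u≤cdist-0 with cdist-sel s q
    ... | inj₁ x with fwd-cases s q s<m
    ...   | inj₁ (sq , e2) = by-span apex-span
      where
      u+s≡q : u + s ≡ q
      u+s≡q = trans (cong (_+ s) (trans (sym h) x)) e2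
      by-span : ((suc s ≡ m) ⊎ (suc (suc s) ≡ m × 4 ≤ m)) → q ≡ u ⊎ q ≡ s ∸ u ⊎ (q ≡ m ∸ 1 × u ≡ 1)
      by-span (inj₁ e4) = inj₂ (inj₁ (trans qs (cong (s ∸_) (sym u0'))))
        where
        qs : q ≡ s
        qs = ≤-antisym (≤-pred (≤-trans q<m (≤-reflexive (sym e4)))) sq
        u0' : u ≡ 0
        u0' = +-cancelʳ-≡ s u 0 (trans u+s≡q qs)
      by-span (inj₂ (e4 , _)) = by-excess u u+s≡q
        where
        by-excess : ∀ w → w + s ≡ q → q ≡ w ⊎ q ≡ s ∸ w ⊎ (q ≡ m ∸ 1 × w ≡ 1)
        by-excess zero us' = inj₂ (inj₁ (sym us'))
        by-excess (suc zero) us' = inj₂ (inj₂ (trans (sym us') (cong (_∸ 1) e4) , refl))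
        by-excess (suc (suc u')) us' = ⊥-elim (<⇒≱ q<m (≤-trans (≤-reflexive (sym e4)) (≤-trans (s≤s (s≤s (m≤n+m s u'))) (≤-reflexive us'))))
    ...   | inj₂ (qs , e2) = ⊥-elim (<⇒≱ (+-monoʳ-< q s<m) (≤-trans (≤-reflexive (sym e2)) (≤-trans (≤-reflexive (cong (_+ s) (trans (sym x) h))) (+-monoˡ-≤ s (≤-trans u≤cdist-0 (cdist≤fwd 0 q))))))
    level-via-s q u q<m h u≤cdist-0 | inj₂ x with fwd-cases q s q<m
    ... | inj₁ (_ , e2) = inj₂ (inj₁ (sym (trans (cong (_∸ u) (sym e3)) (m+n∸m≡n u q))))
      where
      e3 : u + q ≡ s
      e3 = trans (cong (_+ q) (trans (sym h) x)) e2
    ... | inj₂ (sq , e2) with fwd-cases q 0 q<m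
    ...   | inj₁ (le , _) = ⊥-elim (<⇒≱ (≤-<-trans z≤n sq) le)
    ...   | inj₂ (_ , e5) = ⊥-elim (<⇒≱ (+-monoˡ-< m (≤-trans (s≤s z≤n) 2≤s)) (≤-trans (≤-reflexive (trans (sym e2) (cong (_+ q) (trans (sym x) h)))) (≤-trans (+-monoˡ-≤ q (≤-trans u≤cdist-0 (cdist≤bwd 0 q))) (≤-reflexive e5))))

  -- The last case arises only for s = m - 2: position m - 1 lies between s and 0.
  apexDist-level : ∀ q u → q < m → cdist 0 q ⊓ cdist s q ≡ u → q ≡ u ⊎ q ≡ s ∸ u ⊎ (q ≡ m ∸ 1 × u ≡ 1)
  apexDist-level q u q<m e with ⊓-sel-≤ (cdist 0 q) (cdist s q) u e
  ... | inj₁ (h , u≤cdist-s) = level-via-0 q u q<m h u≤cdist-s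
  ... | inj₂ (h , u≤cdist-0) = level-via-s q u q<m h u≤cdist-0

  2*apexDist≤1+m : ∀ p → p < m → 2 * apexDist p ≤ suc m
  2*apexDist≤1+m p p<m rewrite 2*-suc (cdist 0 p ⊓ cdist s p) = by-side-of-s (p ≤? s)
    where
    X : ℕ
    X = cdist 0 p ⊓ cdist s p
    by-side-of-s : Dec (p ≤ s) → suc (suc (2 * X)) ≤ suc m
    by-side-of-s (yes ps) with fwd-cases p s p<m
    ... | inj₂ (lt , _) = ⊥-elim (<⇒≱ lt ps)
    ... | inj₁ (_ , e) = s≤s (≤-trans (s≤s (≤-trans (2*⊓≤+ (cdist 0 p) (cdist s p)) (≤-trans (+-mono-≤ (cdist≤fwd 0 p) (cdist≤bwd s p)) (≤-reflexive (trans (+-comm p _) e))))) s<m)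
    by-side-of-s (no nps) = by-span apex-span
      where
      by-span : ((suc s ≡ m) ⊎ (suc (suc s) ≡ m × 4 ≤ m)) → suc (suc (2 * X)) ≤ suc m
      by-span (inj₁ e4) = ⊥-elim (nps (≤-pred (≤-trans p<m (≤-reflexive (sym e4)))))
      by-span (inj₂ (e4 , m4)) with fwd-cases p 0 p<m
      ... | inj₁ (le , _) = ⊥-elim (<⇒≱ (≤-<-trans z≤n (≰⇒> nps)) le)
      ... | inj₂ (_ , e5) = ≤-trans (s≤s (s≤s (*-monoʳ-≤ 2 X≤1))) (≤-trans m4 (n≤1+n m))
        where
        f1 : fwd p 0 ≤ 1
        f1 = +-cancelʳ-≤ p (fwd p 0) 1 (≤-trans (≤-reflexive e5) (≤-trans (≤-reflexive (sym e4)) (s≤s (≰⇒> nps))))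
        X≤1 : X ≤ 1
        X≤1 = ≤-trans (m⊓n≤m _ _) (≤-trans (cdist≤bwd 0 p) f1)

  isApex : Fin n → Bool
  isApex x = does (x ≟F z)

  isApex-apex : isApex z ≡ true
  isApex-apex with z ≟F z
  ... | yes _ = refl
  ... | no z≢z = ⊥-elim (z≢z refl)

  notApex : ∀ x → ¬ x ≡ z → not (isApex x) ≡ true
  notApex x x≢z with x ≟F z
  ... | yes x≡z = ⊥-elim (x≢z x≡z)
  ... | no _ = refl

  notApex⁻¹ : ∀ x → not (isApex x) ≡ true → ¬ x ≡ z
  notApex⁻¹ x e refl rewrite isApex-apex with () ← e

  apex-unique : AtMostOne isApex
  apex-unique x y x≡z y≡z with x ≟F z | y ≟F z
  apex-unique x y _ _ | yes refl | yes refl = refl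

  on-cycle-unique : ∀ (f : ℕ → ℕ) → (∀ q q′ → q < m → q′ < m → f q ≡ f q′ → q ≡ q′) →
                    ∀ t → AtMostOne (λ x → not (isApex x) ∧ (f (pos x) ≡ᵇ t))
  on-cycle-unique f f-injective t x y fx fy with nx , fx≡t ← ∧-true⁻¹ {not (isApex x)} fx | ny , fy≡t ← ∧-true⁻¹ {not (isApex y)} fy =
    pos-injective x y (notApex⁻¹ x nx) (notApex⁻¹ y ny)
      (f-injective (pos x) (pos y) (pos<m x) (pos<m y) (trans (≡ᵇ-true⁻¹ fx≡t) (sym (≡ᵇ-true⁻¹ fy≡t))))

  at-pos-unique : ∀ c → AtMostOne (λ x → not (isApex x) ∧ (pos x ≡ᵇ c))
  at-pos-unique = on-cycle-unique (λ q → q) (λ _ _ _ _ e → e)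

  layer≡hLayer : ∀ v t → count (λ x → dist Γ v x ≡ᵇ t) ≡ count (λ x → hDist v x ≡ᵇ t)
  layer≡hLayer v t = sum-cong-≗ (λ x → cong (λ d → 𝟙 (d ≡ᵇ t)) (dist≡hDist v x))

  -- A vertex at distance t from the cycle vertex v is reached going forward, going backward, or
  -- through the apex.
  cycle-vertex-layer : ∀ v → ¬ v ≡ z → ∀ t → count (λ x → dist Γ v x ≡ᵇ t) ≤ 2 + 𝟙 (apexDist (pos v) ≡ᵇ t)
  cycle-vertex-layer v v≢z t = ≤-trans (≤-reflexive (layer≡hLayer v t))
    (count-≤2+𝟙 _ _ _ isApex (apexDist (pos v) ≡ᵇ t)
       (on-cycle-unique (fwd (pos v)) (λ q q′ q<m q′<m → fwd-injectiveʳ (pos v) q q′ (pos<m v) q<m q′<m) t)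
       (on-cycle-unique (λ q → fwd q (pos v)) (λ q q′ q<m q′<m → fwd-injectiveˡ q q′ (pos v) (pos<m v) q<m q′<m) t)
       apex-unique covered)
    where
    covered : ∀ x → (hDist v x ≡ᵇ t) ≡ true →
              not (isApex x) ∧ (fwd (pos v) (pos x) ≡ᵇ t) ≡ true ⊎ not (isApex x) ∧ (fwd (pos x) (pos v) ≡ᵇ t) ≡ true ⊎
              (apexDist (pos v) ≡ᵇ t) ∧ isApex x ≡ true
    covered x at-t with apex? x
    ... | inj₁ refl = inj₂ (inj₂ (∧-true (trans (cong (_≡ᵇ t) (sym (hDist-to-apex v v≢z))) at-t) isApex-apex))
    ... | inj₂ x≢z with cdist-sel (pos v) (pos x)
    ... | inj₁ fwd-side = inj₁ (∧-true (notApex x x≢z) (≡ᵇ-true (trans (sym fwd-side) (trans (sym (hDist-cycle v x v≢z x≢z)) (≡ᵇ-true⁻¹ at-t)))))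
    ... | inj₂ bwd-side = inj₂ (inj₁ (∧-true (notApex x x≢z) (≡ᵇ-true (trans (sym bwd-side) (trans (sym (hDist-cycle v x v≢z x≢z)) (≡ᵇ-true⁻¹ at-t))))))

  apex-layer : ∀ u → count (λ x → dist Γ z x ≡ᵇ suc u) ≤ 2 + 𝟙 (u ≡ᵇ 1)
  apex-layer u = ≤-trans (≤-reflexive (layer≡hLayer z (suc u)))
    (count-≤2+𝟙 _ _ _ _ (u ≡ᵇ 1) (at-pos-unique u) (at-pos-unique (s ∸ u)) (at-pos-unique (m ∸ 1)) covered)
    where
    covered : ∀ x → (hDist z x ≡ᵇ suc u) ≡ true →
              not (isApex x) ∧ (pos x ≡ᵇ u) ≡ true ⊎ not (isApex x) ∧ (pos x ≡ᵇ s ∸ u) ≡ true ⊎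
              (u ≡ᵇ 1) ∧ (not (isApex x) ∧ (pos x ≡ᵇ m ∸ 1)) ≡ true
    covered x at-u with apex? x
    ... | inj₁ refl with () ← trans (cong (_≡ᵇ suc u) (sym hDist-apex-apex)) at-u
    ... | inj₂ x≢z with apexDist-level (pos x) u (pos<m x) (suc-injective (trans (sym (hDist-apex x x≢z)) (≡ᵇ-true⁻¹ at-u)))
    ... | inj₁ e = inj₁ (∧-true (notApex x x≢z) (≡ᵇ-true e))
    ... | inj₂ (inj₁ e) = inj₂ (inj₁ (∧-true (notApex x x≢z) (≡ᵇ-true e)))
    ... | inj₂ (inj₂ (e , u≡1)) = inj₂ (inj₂ (∧-true (≡ᵇ-true u≡1) (∧-true (notApex x x≢z) (≡ᵇ-true e))))

  thin-levels : ThinLevels Γ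
  thin-levels v with apex? v
  ... | inj₁ refl = 2 , s≤s z≤n , ≤-trans (s≤s 3≤m) (≤-reflexive (sym n≡1+m)) , thin , ≤-trans (apex-layer 1) ≤-refl
    where
    thin : ∀ t → 1 ≤ t → ¬ t ≡ 2 → count (λ x → dist Γ z x ≡ᵇ t) ≤ 2
    thin (suc u) _ t≢2 = ≤-trans (apex-layer u) (≤-reflexive (cong (λ b → 2 + 𝟙 b) (≡ᵇ-false (t≢2 ∘ cong suc))))
  ... | inj₂ v≢z = apexDist (pos v) , s≤s z≤n , ≤-trans (2*apexDist≤1+m (pos v) (pos<m v)) (≤-reflexive (sym n≡1+m)) , thin ,
                    ≤-trans (cycle-vertex-layer v v≢z (apexDist (pos v))) (+-monoʳ-≤ 2 (𝟙≤1 _))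
    where
    thin : ∀ t → 1 ≤ t → ¬ t ≡ apexDist (pos v) → count (λ x → dist Γ v x ≡ᵇ t) ≤ 2
    thin t _ t≢K = ≤-trans (cycle-vertex-layer v v≢z t) (≤-reflexive (cong (λ b → 2 + 𝟙 b) (≡ᵇ-false (t≢K ∘ sym))))

route : ℕ → ℕ → ℕ → List ℕ
route a s c = a ∷ (upFrom s c ++ 1 ∷ [])

consecutive-route⁻¹ : ∀ a s c i j → consecutive (route a s c) i j ≡ true →
  (i ≡ a × j ≡ s × 1 ≤ c) ⊎ (c ≡ 0 × i ≡ a × j ≡ 1) ⊎ (s ≤ i × j ≡ suc i × suc i < s + c) ⊎ (suc i ≡ s + c × j ≡ 1 × 1 ≤ c)
consecutive-route⁻¹ a s zero i j e with ∨-true⁻¹ {(a ≡ᵇ i) ∧ (1 ≡ᵇ j)} e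
... | inj₁ a,1 with a≡i , 1≡j ← ∧-true⁻¹ {a ≡ᵇ i} a,1 = inj₂ (inj₁ (refl , sym (≡ᵇ-true⁻¹ a≡i) , sym (≡ᵇ-true⁻¹ 1≡j)))
consecutive-route⁻¹ a s (suc c) i j e with ∨-true⁻¹ {(a ≡ᵇ i) ∧ (s ≡ᵇ j)} e
... | inj₁ a,s with a≡i , s≡j ← ∧-true⁻¹ {a ≡ᵇ i} a,s = inj₁ (sym (≡ᵇ-true⁻¹ a≡i) , sym (≡ᵇ-true⁻¹ s≡j) , s≤s z≤n)
... | inj₂ later with consecutive-route⁻¹ s (suc s) c i j later
... | inj₁ (refl , refl , 1≤c) = inj₂ (inj₂ (inj₁ (≤-refl , refl , ≤-trans (≤-reflexive (+-comm 2 i)) (+-monoʳ-≤ i (s≤s 1≤c)))))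
... | inj₂ (inj₁ (refl , refl , refl)) = inj₂ (inj₂ (inj₂ (sym (+-comm i 1) , refl , s≤s z≤n)))
... | inj₂ (inj₂ (inj₁ (s<i , j≡1+i , 1+i<end))) = inj₂ (inj₂ (inj₁ (<⇒≤ s<i , j≡1+i , ≤-trans 1+i<end (≤-reflexive (sym (+-suc s c))))))
... | inj₂ (inj₂ (inj₂ (1+i≡end , j≡1 , _))) = inj₂ (inj₂ (inj₂ (trans 1+i≡end (sym (+-suc s c)) , j≡1 , s≤s z≤n)))

consecutive-route-head : ∀ a s c → 1 ≤ c → consecutive (route a s c) a s ≡ true
consecutive-route-head a s (suc c) _ rewrite ≡ᵇ-refl a | ≡ᵇ-refl s = refl

consecutive-route-step : ∀ a s c i → s ≤ i → suc i < s + c → consecutive (route a s c) i (suc i) ≡ true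
consecutive-route-step a s zero i s≤i 1+i<end = ⊥-elim (<⇒≱ 1+i<end (≤-trans (≤-reflexive (+-identityʳ s)) (m≤n⇒m≤1+n s≤i)))
consecutive-route-step a s (suc c) i s≤i 1+i<end with m≤n⇒m<n∨m≡n s≤i
... | inj₂ refl = ∨-trueʳ ((a ≡ᵇ i) ∧ (i ≡ᵇ suc i)) (consecutive-route-head i (suc i) c (1≤c c 1+i<end))
  where
  1≤c : ∀ c → suc (suc i) ≤ i + suc c → 1 ≤ c
  1≤c zero le rewrite +-comm i 1 = ⊥-elim (<-irrefl refl le)
  1≤c (suc c) _ = s≤s z≤n
... | inj₁ s<i = ∨-trueʳ ((a ≡ᵇ i) ∧ (s ≡ᵇ suc i)) (consecutive-route-step s (suc s) c i s<i (≤-trans 1+i<end (≤-reflexive (+-suc s c))))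

consecutive-route-last : ∀ a s c i → 1 ≤ c → suc i ≡ s + c → consecutive (route a s c) i 1 ≡ true
consecutive-route-last a s (suc zero) i _ e =
  ∨-trueʳ ((a ≡ᵇ i) ∧ (s ≡ᵇ 1)) (∨-trueˡ false (∧-true (≡ᵇ-true (sym (suc-injective (trans e (+-comm s 1))))) refl))
consecutive-route-last a s (suc (suc c)) i _ e =
  ∨-trueʳ ((a ≡ᵇ i) ∧ (s ≡ᵇ 1)) (consecutive-route-last s (suc s) (suc c) i (s≤s z≤n) (trans e (+-suc s (suc c))))

-- Γ = fromRel n E, described by labels: a vertex i ≠ apexLabel sits at cycle position label i.
module Labelled {n} (Γ : Graph n) (m s apexLabel : ℕ) (label : ℕ → ℕ) (E : ℕ → ℕ → Bool)
                (adj≡E : ∀ x y → adj Γ x y ≡ (E (toℕ x) (toℕ y) ∨ E (toℕ y) (toℕ x)) ∧ not (toℕ x ≡ᵇ toℕ y)) where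
  open Cycle m using (next)

  LabelAdj : ℕ → ℕ → Set
  LabelAdj i j = (¬ i ≡ apexLabel × ¬ j ≡ apexLabel × (label j ≡ next (label i) ⊎ label i ≡ next (label j))) ⊎
                 (i ≡ apexLabel × ¬ j ≡ apexLabel × (label j ≡ 0 ⊎ label j ≡ s)) ⊎
                 (j ≡ apexLabel × ¬ i ≡ apexLabel × (label i ≡ 0 ⊎ label i ≡ s))

  labelAdj-sym : ∀ {i j} → LabelAdj i j → LabelAdj j i
  labelAdj-sym (inj₁ (i≢a , j≢a , inj₁ e)) = inj₁ (j≢a , i≢a , inj₂ e)
  labelAdj-sym (inj₁ (i≢a , j≢a , inj₂ e)) = inj₁ (j≢a , i≢a , inj₁ e)
  labelAdj-sym (inj₂ (inj₁ x)) = inj₂ (inj₂ x)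
  labelAdj-sym (inj₂ (inj₂ x)) = inj₂ (inj₁ x)

  Linked : ℕ → ℕ → Set
  Linked i j = (E i j ≡ true ⊎ E j i ≡ true) × ¬ i ≡ j

  linked⇒adj : ∀ x y {i j} → toℕ x ≡ i → toℕ y ≡ j → Linked i j → adj Γ x y ≡ true
  linked⇒adj x y refl refl (E-xy , x≢y) = trans (adj≡E x y) (∧-true (either E-xy) (subst (λ b → not b ≡ true) (sym (≡ᵇ-false x≢y)) refl))
    where
    either : E (toℕ x) (toℕ y) ≡ true ⊎ E (toℕ y) (toℕ x) ≡ true → E (toℕ x) (toℕ y) ∨ E (toℕ y) (toℕ x) ≡ true
    either (inj₁ e) = ∨-trueˡ _ e
    either (inj₂ e) = ∨-trueʳ (E (toℕ x) (toℕ y)) e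

  module ByLabels
    (n≡1+m : n ≡ suc m) (3≤m : 3 ≤ m) (apexLabel<n : apexLabel < n)
    (label<m : ∀ i → i < n → label i < m)
    (label-injective : ∀ i j → i < n → j < n → ¬ i ≡ apexLabel → ¬ j ≡ apexLabel → label i ≡ label j → i ≡ j)
    (apex-span : (suc s ≡ m) ⊎ (suc (suc s) ≡ m × 4 ≤ m))
    (E⇒labelAdj : ∀ i j → E i j ≡ true → LabelAdj i j)
    (next-label : ∀ i → i < n → ¬ i ≡ apexLabel → Σ ℕ λ j → j < n × ¬ j ≡ apexLabel × label j ≡ next (label i) × Linked j i)
    (prev-label : ∀ i → i < n → ¬ i ≡ apexLabel → Σ ℕ λ j → j < n × ¬ j ≡ apexLabel × next (label j) ≡ label i × Linked j i)
    (apex-0-label : Σ ℕ λ j → j < n × ¬ j ≡ apexLabel × label j ≡ 0 × Linked j apexLabel)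
    (apex-s-label : Σ ℕ λ j → j < n × ¬ j ≡ apexLabel × label j ≡ s × Linked j apexLabel)
    where

    private
      apex : Fin n
      apex = fromℕ< apexLabel<n

      toℕ-apex : toℕ apex ≡ apexLabel
      toℕ-apex = toℕ-fromℕ< apexLabel<n

      pos : Fin n → ℕ
      pos x = label (toℕ x)

      ≢apex : ∀ x → ¬ toℕ x ≡ apexLabel → ¬ x ≡ apex
      ≢apex x x≢a refl = x≢a toℕ-apex

      ≢apexLabel : ∀ x → ¬ x ≡ apex → ¬ toℕ x ≡ apexLabel
      ≢apexLabel x x≢a e = x≢a (toℕ-injective (trans e (sym toℕ-apex)))

      ≡apex : ∀ x → toℕ x ≡ apexLabel → x ≡ apex
      ≡apex x e = toℕ-injective (trans e (sym toℕ-apex))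

      pos<m : ∀ x → pos x < m
      pos<m x = label<m (toℕ x) (toℕ<n x)

      pos-injective : ∀ x y → ¬ x ≡ apex → ¬ y ≡ apex → pos x ≡ pos y → x ≡ y
      pos-injective x y x≢a y≢a e = toℕ-injective (label-injective (toℕ x) (toℕ y) (toℕ<n x) (toℕ<n y) (≢apexLabel x x≢a) (≢apexLabel y y≢a) e)

      adj⇒labelAdj : ∀ x y → adj Γ x y ≡ true → LabelAdj (toℕ x) (toℕ y)
      adj⇒labelAdj x y xy with ∨-true⁻¹ {E (toℕ x) (toℕ y)} (proj₁ (∧-true⁻¹ {E (toℕ x) (toℕ y) ∨ E (toℕ y) (toℕ x)} (trans (sym (adj≡E x y)) xy)))
      ... | inj₁ e = E⇒labelAdj _ _ e
      ... | inj₂ e = labelAdj-sym (E⇒labelAdj _ _ e)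

      adj-cases : ∀ x y → adj Γ x y ≡ true →
         (¬ x ≡ apex × ¬ y ≡ apex × (pos y ≡ next (pos x) ⊎ pos x ≡ next (pos y))) ⊎
         (x ≡ apex × ¬ y ≡ apex × (pos y ≡ 0 ⊎ pos y ≡ s)) ⊎
         (y ≡ apex × ¬ x ≡ apex × (pos x ≡ 0 ⊎ pos x ≡ s))
      adj-cases x y xy with adj⇒labelAdj x y xy
      ... | inj₁ (x≢a , y≢a , c) = inj₁ (≢apex x x≢a , ≢apex y y≢a , c)
      ... | inj₂ (inj₁ (x≡a , y≢a , c)) = inj₂ (inj₁ (≡apex x x≡a , ≢apex y y≢a , c))
      ... | inj₂ (inj₂ (y≡a , x≢a , c)) = inj₂ (inj₂ (≡apex y y≡a , ≢apex x x≢a , c))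

      neighbour : ∀ (P : ℕ → Set) (target : Fin n) →
                  (Σ ℕ λ j → j < n × ¬ j ≡ apexLabel × P (label j) × Linked j (toℕ target)) →
                  Σ (Fin n) λ y → ¬ y ≡ apex × P (pos y) × adj Γ y target ≡ true
      neighbour P target (j , j<n , j≢a , Pj , linked) =
        fromℕ< j<n , ≢apex (fromℕ< j<n) (λ e → j≢a (trans (sym (toℕ-fromℕ< j<n)) e)) ,
        subst P (cong label (sym (toℕ-fromℕ< j<n))) Pj , linked⇒adj (fromℕ< j<n) target (toℕ-fromℕ< j<n) refl linked

      apex-neighbour : ∀ c → (Σ ℕ λ j → j < n × ¬ j ≡ apexLabel × label j ≡ c × Linked j apexLabel) →
                       Σ (Fin n) λ y → ¬ y ≡ apex × pos y ≡ c × adj Γ y apex ≡ true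
      apex-neighbour c (j , j<n , j≢a , lj≡c , linked) = neighbour (_≡ c) apex (j , j<n , j≢a , lj≡c , subst (Linked j) (sym toℕ-apex) linked)

    open ApexOverCycle Γ m s apex pos n≡1+m 3≤m pos<m pos-injective apex-span adj-cases
      (λ x x≢a → neighbour (_≡ next (pos x)) x (next-label (toℕ x) (toℕ<n x) (≢apexLabel x x≢a)))
      (λ x x≢a → neighbour (λ l → next l ≡ pos x) x (prev-label (toℕ x) (toℕ<n x) (≢apexLabel x x≢a)))
      (apex-neighbour 0 apex-0-label) (apex-neighbour s apex-s-label) public using (thin-levels; connected)

-- The cycle runs through 0, 3, 4, …, n - 1, 1 and the apex is vertex 2.
module H-1-2 (k : ℕ) where
  n m s : ℕ
  n = suc (suc (suc (suc k)))
  m = suc (suc (suc k))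
  s = suc (suc k)
  open Cycle m using (next; next-last; next-mid)

  edgeRel : ℕ → ℕ → Bool
  edgeRel i j = consecutive (pathThrough 2 0) i j ∨ (consecutive (pathThrough 2 1) i j ∨ consecutive (pathThrough 3 (suc k)) i j)

  label : ℕ → ℕ
  label 0 = 0
  label 1 = s
  label 2 = 0
  label (suc (suc (suc j))) = suc j

  open Labelled (H (suc (suc (suc (suc k)))) 1 2) m s 2 label edgeRel (λ _ _ → refl)

  Edge : ℕ → ℕ → Set
  Edge i j = (i ≡ 0 × j ≡ 1) ⊎ (i ≡ 0 × j ≡ 2) ⊎ (i ≡ 2 × j ≡ 1) ⊎ (i ≡ 0 × j ≡ 3) ⊎ (3 ≤ i × j ≡ suc i × suc i < n) ⊎ (suc i ≡ n × j ≡ 1)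

  edge-cases : ∀ i j → edgeRel i j ≡ true → Edge i j
  edge-cases i j e with ∨-true⁻¹ {consecutive (pathThrough 2 0) i j} e
  ... | inj₁ c with consecutive-route⁻¹ 0 2 0 i j c
  ...   | inj₁ (_ , _ , ())
  ...   | inj₂ (inj₁ (_ , ei , ej)) = inj₁ (ei , ej)
  ...   | inj₂ (inj₂ (inj₁ (l1 , _ , l2))) = ⊥-elim (<⇒≱ l2 (≤-trans (s≤s (s≤s z≤n)) (s≤s l1)))
  ...   | inj₂ (inj₂ (inj₂ (_ , _ , ())))
  edge-cases i j e | inj₂ r with ∨-true⁻¹ {consecutive (pathThrough 2 1) i j} r
  ... | inj₁ c with consecutive-route⁻¹ 0 2 1 i j c
  ...   | inj₁ (ei , ej , _) = inj₂ (inj₁ (ei , ej))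
  ...   | inj₂ (inj₁ (() , _))
  ...   | inj₂ (inj₂ (inj₁ (l1 , _ , l2))) = ⊥-elim (<⇒≱ l2 (s≤s l1))
  ...   | inj₂ (inj₂ (inj₂ (ei , ej , _))) = inj₂ (inj₂ (inj₁ (suc-injective ei , ej)))
  edge-cases i j e | inj₂ r | inj₂ c with consecutive-route⁻¹ 0 3 (suc k) i j c
  ... | inj₁ (ei , ej , _) = inj₂ (inj₂ (inj₂ (inj₁ (ei , ej))))
  ... | inj₂ (inj₁ (() , _))
  ... | inj₂ (inj₂ (inj₁ (l1 , ej , l2))) = inj₂ (inj₂ (inj₂ (inj₂ (inj₁ (l1 , ej , l2)))))
  ... | inj₂ (inj₂ (inj₂ (ei , ej , _))) = inj₂ (inj₂ (inj₂ (inj₂ (inj₂ (ei , ej)))))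

  edge⇒labelAdj : ∀ i j → Edge i j → LabelAdj i j
  edge⇒labelAdj .0 .1 (inj₁ (refl , refl)) = inj₁ ((λ ()) , (λ ()) , inj₂ (sym (next-last refl)))
  edge⇒labelAdj .0 .2 (inj₂ (inj₁ (refl , refl))) = inj₂ (inj₂ (refl , (λ ()) , inj₁ refl))
  edge⇒labelAdj .2 .1 (inj₂ (inj₂ (inj₁ (refl , refl)))) = inj₂ (inj₁ (refl , (λ ()) , inj₂ refl))
  edge⇒labelAdj .0 .3 (inj₂ (inj₂ (inj₂ (inj₁ (refl , refl))))) = inj₁ ((λ ()) , (λ ()) , inj₁ refl)
  edge⇒labelAdj (suc (suc (suc i'))) j (inj₂ (inj₂ (inj₂ (inj₂ (inj₁ (_ , refl , l2)))))) = inj₁ ((λ ()) , (λ ()) , inj₁ (sym (next-mid (≤-trans (n≤1+n _) (≤-pred l2)))))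
  edge⇒labelAdj 0 j (inj₂ (inj₂ (inj₂ (inj₂ (inj₁ (() , _ , _))))))
  edge⇒labelAdj 1 j (inj₂ (inj₂ (inj₂ (inj₂ (inj₁ (s≤s () , _ , _))))))
  edge⇒labelAdj 2 j (inj₂ (inj₂ (inj₂ (inj₂ (inj₁ (s≤s (s≤s ()) , _ , _))))))
  edge⇒labelAdj i j (inj₂ (inj₂ (inj₂ (inj₂ (inj₂ (ei , refl)))))) with suc-injective ei
  ... | refl = inj₁ ((λ ()) , (λ ()) , inj₁ (sym (next-mid ≤-refl)))

  path₁-edge : ∀ i j → consecutive (pathThrough 2 0) i j ≡ true → edgeRel i j ≡ true
  path₁-edge i j c = ∨-trueˡ _ c
  path₂-edge : ∀ i j → consecutive (pathThrough 2 1) i j ≡ true → edgeRel i j ≡ true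
  path₂-edge i j c = ∨-trueʳ (consecutive (pathThrough 2 0) i j) (∨-trueˡ _ c)
  path₃-edge : ∀ i j → consecutive (pathThrough 3 (suc k)) i j ≡ true → edgeRel i j ≡ true
  path₃-edge i j c = ∨-trueʳ (consecutive (pathThrough 2 0) i j) (∨-trueʳ (consecutive (pathThrough 2 1) i j) c)

  label<m : ∀ i → i < n → label i < m
  label<m 0 _ = s≤s z≤n
  label<m 1 _ = ≤-refl
  label<m 2 _ = s≤s z≤n
  label<m (suc (suc (suc j))) (s≤s (s≤s (s≤s lt))) = s≤s (≤-trans lt (n≤1+n _))

  label-injective : ∀ i j → i < n → j < n → ¬ i ≡ 2 → ¬ j ≡ 2 → label i ≡ label j → i ≡ j
  label-injective 0 0 _ _ _ _ _ = refl
  label-injective 1 1 _ _ _ _ _ = refl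
  label-injective 2 _ _ _ ni _ _ = ⊥-elim (ni refl)
  label-injective _ 2 _ _ _ nj _ = ⊥-elim (nj refl)
  label-injective 0 1 _ _ _ _ ()
  label-injective 1 0 _ _ _ _ ()
  label-injective 0 (suc (suc (suc j))) _ _ _ _ ()
  label-injective (suc (suc (suc j))) 0 _ _ _ _ ()
  label-injective 1 (suc (suc (suc j))) _ (s≤s (s≤s (s≤s lt))) _ _ e = ⊥-elim (<-irrefl (sym (suc-injective e)) lt)
  label-injective (suc (suc (suc j))) 1 (s≤s (s≤s (s≤s lt))) _ _ _ e = ⊥-elim (<-irrefl (suc-injective e) lt)
  label-injective (suc (suc (suc i))) (suc (suc (suc j))) _ _ _ _ e = cong (λ w → suc (suc w)) e

  next-label : ∀ i → i < n → ¬ i ≡ 2 → Σ ℕ λ j → j < n × ¬ j ≡ 2 × label j ≡ next (label i) × Linked j i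
  next-label 0 _ _ = 3 , s≤s (s≤s (s≤s (s≤s z≤n))) , (λ ()) , refl , (inj₂ (path₃-edge 0 3 (consecutive-route-head 0 3 (suc k) (s≤s z≤n))) , (λ ()))
  next-label 1 _ _ = 0 , s≤s z≤n , (λ ()) , sym (next-last refl) , (inj₁ (path₁-edge 0 1 refl) , (λ ()))
  next-label 2 _ n2 = ⊥-elim (n2 refl)
  next-label (suc (suc (suc i'))) (s≤s (s≤s (s≤s (s≤s lt)))) _ with m≤n⇒m<n∨m≡n lt
  ... | inj₁ lt' = suc (suc (suc (suc i'))) , s≤s (s≤s (s≤s (s≤s lt'))) , (λ ()) , sym (next-mid (s≤s (s≤s (s≤s (≤-trans (n≤1+n _) lt'))))) ,
                   (inj₂ (path₃-edge (suc (suc (suc i'))) (suc (suc (suc (suc i')))) (consecutive-route-step 0 3 (suc k) (suc (suc (suc i'))) (s≤s (s≤s (s≤s z≤n))) (s≤s (s≤s (s≤s (s≤s lt')))))) , (λ e → <-irrefl (sym e) ≤-refl))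
  ... | inj₂ refl = 1 , s≤s (s≤s z≤n) , (λ ()) , sym (next-mid ≤-refl) , (inj₂ (path₃-edge (suc (suc (suc k))) 1 (consecutive-route-last 0 3 (suc k) (suc (suc (suc k))) (s≤s z≤n) refl)) , (λ ()))

  prev-label : ∀ i → i < n → ¬ i ≡ 2 → Σ ℕ λ j → j < n × ¬ j ≡ 2 × next (label j) ≡ label i × Linked j i
  prev-label 0 _ _ = 1 , s≤s (s≤s z≤n) , (λ ()) , next-last refl , (inj₂ (path₁-edge 0 1 refl) , (λ ()))
  prev-label 1 _ _ = suc (suc (suc k)) , ≤-refl , (λ ()) , next-mid ≤-refl , (inj₁ (path₃-edge (suc (suc (suc k))) 1 (consecutive-route-last 0 3 (suc k) (suc (suc (suc k))) (s≤s z≤n) refl)) , (λ ()))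
  prev-label 2 _ n2 = ⊥-elim (n2 refl)
  prev-label 3 _ _ = 0 , s≤s z≤n , (λ ()) , refl , (inj₁ (path₃-edge 0 3 (consecutive-route-head 0 3 (suc k) (s≤s z≤n))) , (λ ()))
  prev-label (suc (suc (suc (suc i')))) (s≤s (s≤s (s≤s (s≤s lt)))) _ = suc (suc (suc i')) , s≤s (s≤s (s≤s (s≤s (≤-trans (n≤1+n _) lt)))) , (λ ()) , next-mid (s≤s (s≤s (s≤s (≤-trans (n≤1+n _) lt)))) ,
       (inj₁ (path₃-edge (suc (suc (suc i'))) (suc (suc (suc (suc i')))) (consecutive-route-step 0 3 (suc k) (suc (suc (suc i'))) (s≤s (s≤s (s≤s z≤n))) (s≤s (s≤s (s≤s (s≤s lt)))))) , (λ e → <-irrefl e ≤-refl))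

  apex-0-label : Σ ℕ λ j → j < n × ¬ j ≡ 2 × label j ≡ 0 × Linked j 2
  apex-0-label = 0 , s≤s z≤n , (λ ()) , refl , (inj₁ (path₂-edge 0 2 (consecutive-route-head 0 2 1 (s≤s z≤n))) , (λ ()))

  apex-s-label : Σ ℕ λ j → j < n × ¬ j ≡ 2 × label j ≡ s × Linked j 2
  apex-s-label = 1 , s≤s (s≤s z≤n) , (λ ()) , refl , (inj₂ (path₂-edge 2 1 (consecutive-route-last 0 2 1 2 (s≤s z≤n) refl)) , (λ ()))

  E⇒labelAdj : ∀ i j → edgeRel i j ≡ true → LabelAdj i j
  E⇒labelAdj i j e = edge⇒labelAdj i j (edge-cases i j e)

  open ByLabels refl (s≤s (s≤s (s≤s z≤n))) (s≤s (s≤s (s≤s z≤n))) label<m label-injective (inj₁ refl) E⇒labelAdj next-label prev-label apex-0-label apex-s-label public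

-- The cycle runs through 0, 4, 5, …, n - 1, 1, 2 and the apex is vertex 3.
module H-2-2 (k : ℕ) where
  n m s : ℕ
  n = suc (suc (suc (suc (suc k))))
  m = suc (suc (suc (suc k)))
  s = suc (suc k)
  open Cycle m using (next; next-last; next-mid)

  edgeRel : ℕ → ℕ → Bool
  edgeRel i j = consecutive (pathThrough 2 1) i j ∨ (consecutive (pathThrough 3 1) i j ∨ consecutive (pathThrough 4 (suc k)) i j)

  label : ℕ → ℕ
  label 0 = 0
  label 1 = s
  label 2 = suc s
  label 3 = 0
  label (suc (suc (suc (suc j)))) = suc j

  open Labelled (H (suc (suc (suc (suc (suc k))))) 2 2) m s 3 label edgeRel (λ _ _ → refl)

  Edge : ℕ → ℕ → Set
  Edge i j = (i ≡ 0 × j ≡ 2) ⊎ (i ≡ 2 × j ≡ 1) ⊎ (i ≡ 0 × j ≡ 3) ⊎ (i ≡ 3 × j ≡ 1) ⊎ (i ≡ 0 × j ≡ 4) ⊎ (4 ≤ i × j ≡ suc i × suc i < n) ⊎ (suc i ≡ n × j ≡ 1)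

  edge-cases : ∀ i j → edgeRel i j ≡ true → Edge i j
  edge-cases i j e with ∨-true⁻¹ {consecutive (pathThrough 2 1) i j} e
  ... | inj₁ c with consecutive-route⁻¹ 0 2 1 i j c
  ...   | inj₁ (ei , ej , _) = inj₁ (ei , ej)
  ...   | inj₂ (inj₁ (() , _))
  ...   | inj₂ (inj₂ (inj₁ (l1 , _ , l2))) = ⊥-elim (<⇒≱ l2 (s≤s l1))
  ...   | inj₂ (inj₂ (inj₂ (ei , ej , _))) = inj₂ (inj₁ (suc-injective ei , ej))
  edge-cases i j e | inj₂ r with ∨-true⁻¹ {consecutive (pathThrough 3 1) i j} r
  ... | inj₁ c with consecutive-route⁻¹ 0 3 1 i j c
  ...   | inj₁ (ei , ej , _) = inj₂ (inj₂ (inj₁ (ei , ej)))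
  ...   | inj₂ (inj₁ (() , _))
  ...   | inj₂ (inj₂ (inj₁ (l1 , _ , l2))) = ⊥-elim (<⇒≱ l2 (s≤s l1))
  ...   | inj₂ (inj₂ (inj₂ (ei , ej , _))) = inj₂ (inj₂ (inj₂ (inj₁ (suc-injective ei , ej))))
  edge-cases i j e | inj₂ r | inj₂ c with consecutive-route⁻¹ 0 4 (suc k) i j c
  ... | inj₁ (ei , ej , _) = inj₂ (inj₂ (inj₂ (inj₂ (inj₁ (ei , ej)))))
  ... | inj₂ (inj₁ (() , _))
  ... | inj₂ (inj₂ (inj₁ (l1 , ej , l2))) = inj₂ (inj₂ (inj₂ (inj₂ (inj₂ (inj₁ (l1 , ej , l2))))))
  ... | inj₂ (inj₂ (inj₂ (ei , ej , _))) = inj₂ (inj₂ (inj₂ (inj₂ (inj₂ (inj₂ (ei , ej))))))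

  edge⇒labelAdj : ∀ i j → Edge i j → LabelAdj i j
  edge⇒labelAdj .0 .2 (inj₁ (refl , refl)) = inj₁ ((λ ()) , (λ ()) , inj₂ (sym (next-last refl)))
  edge⇒labelAdj .2 .1 (inj₂ (inj₁ (refl , refl))) = inj₁ ((λ ()) , (λ ()) , inj₂ (sym (next-mid ≤-refl)))
  edge⇒labelAdj .0 .3 (inj₂ (inj₂ (inj₁ (refl , refl)))) = inj₂ (inj₂ (refl , (λ ()) , inj₁ refl))
  edge⇒labelAdj .3 .1 (inj₂ (inj₂ (inj₂ (inj₁ (refl , refl))))) = inj₂ (inj₁ (refl , (λ ()) , inj₂ refl))
  edge⇒labelAdj .0 .4 (inj₂ (inj₂ (inj₂ (inj₂ (inj₁ (refl , refl)))))) = inj₁ ((λ ()) , (λ ()) , inj₁ refl)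
  edge⇒labelAdj 0 j (inj₂ (inj₂ (inj₂ (inj₂ (inj₂ (inj₁ (() , _ , _)))))))
  edge⇒labelAdj 1 j (inj₂ (inj₂ (inj₂ (inj₂ (inj₂ (inj₁ (s≤s () , _ , _)))))))
  edge⇒labelAdj 2 j (inj₂ (inj₂ (inj₂ (inj₂ (inj₂ (inj₁ (s≤s (s≤s ()) , _ , _)))))))
  edge⇒labelAdj 3 j (inj₂ (inj₂ (inj₂ (inj₂ (inj₂ (inj₁ (s≤s (s≤s (s≤s ())) , _ , _)))))))
  edge⇒labelAdj (suc (suc (suc (suc i')))) j (inj₂ (inj₂ (inj₂ (inj₂ (inj₂ (inj₁ (_ , refl , l2))))))) = inj₁ ((λ ()) , (λ ()) , inj₁ (sym (next-mid (≤-trans (n≤1+n _) (≤-pred (≤-trans (n≤1+n _) l2))))))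
  edge⇒labelAdj i j (inj₂ (inj₂ (inj₂ (inj₂ (inj₂ (inj₂ (ei , refl))))))) with suc-injective ei
  ... | refl = inj₁ ((λ ()) , (λ ()) , inj₁ (sym (next-mid (≤-trans (n≤1+n _) ≤-refl))))

  path₁-edge : ∀ i j → consecutive (pathThrough 2 1) i j ≡ true → edgeRel i j ≡ true
  path₁-edge i j c = ∨-trueˡ _ c
  path₂-edge : ∀ i j → consecutive (pathThrough 3 1) i j ≡ true → edgeRel i j ≡ true
  path₂-edge i j c = ∨-trueʳ (consecutive (pathThrough 2 1) i j) (∨-trueˡ _ c)
  path₃-edge : ∀ i j → consecutive (pathThrough 4 (suc k)) i j ≡ true → edgeRel i j ≡ true
  path₃-edge i j c = ∨-trueʳ (consecutive (pathThrough 2 1) i j) (∨-trueʳ (consecutive (pathThrough 3 1) i j) c)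

  label<m : ∀ i → i < n → label i < m
  label<m 0 _ = s≤s z≤n
  label<m 1 _ = n≤1+n _
  label<m 2 _ = ≤-refl
  label<m 3 _ = s≤s z≤n
  label<m (suc (suc (suc (suc j)))) (s≤s (s≤s (s≤s (s≤s lt)))) = s≤s (≤-trans lt (≤-trans (n≤1+n _) (n≤1+n _)))

  label-injective : ∀ i j → i < n → j < n → ¬ i ≡ 3 → ¬ j ≡ 3 → label i ≡ label j → i ≡ j
  label-injective 3 _ _ _ ni _ _ = ⊥-elim (ni refl)
  label-injective _ 3 _ _ _ nj _ = ⊥-elim (nj refl)
  label-injective 0 0 _ _ _ _ _ = refl
  label-injective 1 1 _ _ _ _ _ = refl
  label-injective 2 2 _ _ _ _ _ = refl
  label-injective 0 1 _ _ _ _ ()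
  label-injective 0 2 _ _ _ _ ()
  label-injective 1 0 _ _ _ _ ()
  label-injective 2 0 _ _ _ _ ()
  label-injective 1 2 _ _ _ _ e = ⊥-elim (<-irrefl e ≤-refl)
  label-injective 2 1 _ _ _ _ e = ⊥-elim (<-irrefl (sym e) ≤-refl)
  label-injective 0 (suc (suc (suc (suc j)))) _ _ _ _ ()
  label-injective (suc (suc (suc (suc j)))) 0 _ _ _ _ ()
  label-injective 1 (suc (suc (suc (suc j)))) _ (s≤s (s≤s (s≤s (s≤s lt)))) _ _ e = ⊥-elim (<-irrefl (sym (suc-injective e)) lt)
  label-injective (suc (suc (suc (suc j)))) 1 (s≤s (s≤s (s≤s (s≤s lt)))) _ _ _ e = ⊥-elim (<-irrefl (suc-injective e) lt)
  label-injective 2 (suc (suc (suc (suc j)))) _ (s≤s (s≤s (s≤s (s≤s lt)))) _ _ e = ⊥-elim (<-irrefl (sym (suc-injective e)) (≤-trans lt (n≤1+n _)))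
  label-injective (suc (suc (suc (suc j)))) 2 (s≤s (s≤s (s≤s (s≤s lt)))) _ _ _ e = ⊥-elim (<-irrefl (suc-injective e) (≤-trans lt (n≤1+n _)))
  label-injective (suc (suc (suc (suc i)))) (suc (suc (suc (suc j)))) _ _ _ _ e = cong (λ w → suc (suc (suc w))) e

  next-label : ∀ i → i < n → ¬ i ≡ 3 → Σ ℕ λ j → j < n × ¬ j ≡ 3 × label j ≡ next (label i) × Linked j i
  next-label 0 _ _ = 4 , s≤s (s≤s (s≤s (s≤s (s≤s z≤n)))) , (λ ()) , refl , (inj₂ (path₃-edge 0 4 (consecutive-route-head 0 4 (suc k) (s≤s z≤n))) , (λ ()))
  next-label 1 _ _ = 2 , s≤s (s≤s (s≤s z≤n)) , (λ ()) , sym (next-mid ≤-refl) , (inj₁ (path₁-edge 2 1 (consecutive-route-last 0 2 1 2 (s≤s z≤n) refl)) , (λ ()))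
  next-label 2 _ _ = 0 , s≤s z≤n , (λ ()) , sym (next-last refl) , (inj₁ (path₁-edge 0 2 (consecutive-route-head 0 2 1 (s≤s z≤n))) , (λ ()))
  next-label 3 _ n3 = ⊥-elim (n3 refl)
  next-label (suc (suc (suc (suc i')))) (s≤s (s≤s (s≤s (s≤s (s≤s lt))))) _ with m≤n⇒m<n∨m≡n lt
  ... | inj₁ lt' = suc (suc (suc (suc (suc i')))) , s≤s (s≤s (s≤s (s≤s (s≤s lt')))) , (λ ()) , sym (next-mid (s≤s (s≤s (s≤s (≤-trans (n≤1+n _) (≤-trans lt' (n≤1+n _))))))) ,
                   (inj₂ (path₃-edge (suc (suc (suc (suc i')))) (suc (suc (suc (suc (suc i'))))) (consecutive-route-step 0 4 (suc k) (suc (suc (suc (suc i')))) (s≤s (s≤s (s≤s (s≤s z≤n)))) (s≤s (s≤s (s≤s (s≤s (s≤s lt'))))))) , (λ e → <-irrefl (sym e) ≤-refl))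
  ... | inj₂ refl = 1 , s≤s (s≤s z≤n) , (λ ()) , sym (next-mid (s≤s (s≤s (s≤s (n≤1+n _))))) , (inj₂ (path₃-edge (suc (suc (suc (suc i')))) 1 (consecutive-route-last 0 4 (suc i') (suc (suc (suc (suc i')))) (s≤s z≤n) refl)) , (λ ()))

  prev-label : ∀ i → i < n → ¬ i ≡ 3 → Σ ℕ λ j → j < n × ¬ j ≡ 3 × next (label j) ≡ label i × Linked j i
  prev-label 0 _ _ = 2 , s≤s (s≤s (s≤s z≤n)) , (λ ()) , next-last refl , (inj₂ (path₁-edge 0 2 (consecutive-route-head 0 2 1 (s≤s z≤n))) , (λ ()))
  prev-label 1 _ _ = suc (suc (suc (suc k))) , ≤-refl , (λ ()) , next-mid (s≤s (s≤s (s≤s (n≤1+n _)))) , (inj₁ (path₃-edge (suc (suc (suc (suc k)))) 1 (consecutive-route-last 0 4 (suc k) (suc (suc (suc (suc k)))) (s≤s z≤n) refl)) , (λ ()))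
  prev-label 2 _ _ = 1 , s≤s (s≤s z≤n) , (λ ()) , next-mid ≤-refl , (inj₂ (path₁-edge 2 1 (consecutive-route-last 0 2 1 2 (s≤s z≤n) refl)) , (λ ()))
  prev-label 3 _ n3 = ⊥-elim (n3 refl)
  prev-label 4 _ _ = 0 , s≤s z≤n , (λ ()) , refl , (inj₁ (path₃-edge 0 4 (consecutive-route-head 0 4 (suc k) (s≤s z≤n))) , (λ ()))
  prev-label (suc (suc (suc (suc (suc i'))))) (s≤s (s≤s (s≤s (s≤s (s≤s lt))))) _ = suc (suc (suc (suc i'))) , s≤s (s≤s (s≤s (s≤s (s≤s (≤-trans (n≤1+n _) lt))))) , (λ ()) , next-mid (s≤s (s≤s (s≤s (≤-trans (n≤1+n _) (≤-trans lt (n≤1+n _)))))) ,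
       (inj₁ (path₃-edge (suc (suc (suc (suc i')))) (suc (suc (suc (suc (suc i'))))) (consecutive-route-step 0 4 (suc k) (suc (suc (suc (suc i')))) (s≤s (s≤s (s≤s (s≤s z≤n)))) (s≤s (s≤s (s≤s (s≤s (s≤s lt))))))) , (λ e → <-irrefl e ≤-refl))

  apex-0-label : Σ ℕ λ j → j < n × ¬ j ≡ 3 × label j ≡ 0 × Linked j 3
  apex-0-label = 0 , s≤s z≤n , (λ ()) , refl , (inj₁ (path₂-edge 0 3 (consecutive-route-head 0 3 1 (s≤s z≤n))) , (λ ()))

  apex-s-label : Σ ℕ λ j → j < n × ¬ j ≡ 3 × label j ≡ s × Linked j 3
  apex-s-label = 1 , s≤s (s≤s z≤n) , (λ ()) , refl , (inj₂ (path₂-edge 3 1 (consecutive-route-last 0 3 1 3 (s≤s z≤n) refl)) , (λ ()))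

  E⇒labelAdj : ∀ i j → edgeRel i j ≡ true → LabelAdj i j
  E⇒labelAdj i j e = edge⇒labelAdj i j (edge-cases i j e)

  open ByLabels refl (s≤s (s≤s (s≤s z≤n))) (s≤s (s≤s (s≤s (s≤s z≤n)))) label<m label-injective (inj₂ (refl , s≤s (s≤s (s≤s (s≤s z≤n))))) E⇒labelAdj next-label prev-label apex-0-label apex-s-label public

lemma4 : (n : ℕ) → 4 ≤ n → (p q : ℕ) → (p ≡ 1 × q ≡ 2) ⊎ (p ≡ 2 × q ≡ 2) →
    q ≤ n ∸ p ∸ q + 1 → (G : Graph n) → TwoConnected G →
    ⁺ sumK G <ℤ b G +ℤ ⁺ sumK (H n p q) →
    W G < W (H n p q)
lemma4 (suc (suc (suc (suc k)))) (s≤s (s≤s (s≤s (s≤s _)))) .1 .2 (inj₁ (refl , refl)) _ G two-connected =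
  W<W-thin {suc (suc k)} G (H (suc (suc (suc (suc k)))) 1 2) two-connected (H-1-2.connected k) (H-1-2.thin-levels k)
lemma4 (suc (suc (suc (suc zero)))) (s≤s (s≤s (s≤s (s≤s _)))) .2 .2 (inj₂ (refl , refl)) (s≤s ()) G two-connected
lemma4 (suc (suc (suc (suc (suc k))))) (s≤s (s≤s (s≤s (s≤s _)))) .2 .2 (inj₂ (refl , refl)) _ G two-connected =
  W<W-thin {suc (suc (suc k))} G (H (suc (suc (suc (suc (suc k))))) 2 2) two-connected (H-2-2.connected k) (H-2-2.thin-levels k)
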